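{- For $n\ge 2$ let $F_n^{1,3}$ be the set of words $\omega_1\cdots\omega_n$ of nonnegative integers such that $\omega_1=0$, $0\le \omega_{i+1}\le\omega_i+1$ for $1\le i\le n-1$, and for every $i$ with $2\le i\le n$, if $\omega_i=0$ then $i\le n-2$ and $\omega_{i+1}\omega_{i+2}=12$. Let $\mathcal{H}_1=\{1324,2314,2413,3124,3142,3214\}$. Then for every $n\ge2$ there is a bijection between $F_n^{1,3}$ and $S_{n-1}(\mathcal{H}_1)$; in particular $|F_n^{1,3}|=|S_{n-1}(\mathcal{H}_1)|$.
   Context: $S_m(\mathcal{E})$ denotes the set of permutations of $\{1,\dots,m\}$ avoiding every pattern in $\mathcal{E}$ (a permutation $\pi$ contains $\tau$ of length $k$ if some indices $i_1<\dots<i_k$ satisfy $\pi(i_a)<\pi(i_b)$ iff $\tau(a)<\tau(b)$). -}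

module Defs where

open import Data.Nat using (ℕ; zero; suc; _+_; _≤_; _<_; s≤s)
open import Data.Nat.Properties using (m<n⇒m<1+n)
open import Data.Fin as Fin using (Fin; fromℕ<)
open import Data.Fin using (#_)
open import Data.Vec using (Vec; []; _∷_; lookup)
open import Data.List using (List; []; _∷_)
open import Data.List.Relation.Unary.All using (All)
open import Data.Product using (Σ; ∃; _×_; proj₁)
open import Relation.Binary.PropositionalEquality using (_≡_)
open import Relation.Nullary using (¬_)
open import Function.Bundles using (_⇔_)

pred< : ∀ {a b} → suc a < b → a < b
pred< {a} {suc b} (s≤s p) = m<n⇒m<1+n p

-- Words ω₁⋯ωₙ are vectors w : Vec ℕ n; the 0-based position i holds ω_{i+1}.
-- ω_(j) (0-based j) is written  lookup w (fromℕ< p)  with p : j < n.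
record IsF13 (n : ℕ) (w : Vec ℕ n) : Set where
  field
    first : (p : 0 < n) → lookup w (fromℕ< p) ≡ 0
    step  : (i : ℕ) (p : suc i < n) →
            lookup w (fromℕ< p) ≤ lookup w (fromℕ< (pred< p)) + 1
    -- for 2 ≤ i ≤ n (1-based), ω_i = 0 ⇒ i ≤ n-2 and ω_{i+1} ω_{i+2} = 1 2
    -- (0-based position j = suc i with 1 ≤ j ≤ n-1)
    zeros : (i : ℕ) (p : suc i < n) → lookup w (fromℕ< p) ≡ 0 →
            Σ (suc (suc (suc i)) < n) λ q →
              (lookup w (fromℕ< (pred< q)) ≡ 1) × (lookup w (fromℕ< q) ≡ 2)

F13 : ℕ → Set
F13 n = Σ (Vec ℕ n) (IsF13 n)

-- Permutations of {1,…,m}, in one-line notation with 0-based values Fin m.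
IsPerm : ∀ {m} → Vec (Fin m) m → Set
IsPerm {m} π = ∀ i j → lookup π i ≡ lookup π j → i ≡ j

Contains : ∀ {m k} → Vec (Fin m) m → Vec (Fin k) k → Set
Contains {m} {k} π τ =
  Σ (Fin k → Fin m) λ f →
    (∀ a b → a Fin.< b → f a Fin.< f b) ×
    (∀ a b → (lookup π (f a) Fin.< lookup π (f b)) ⇔ (lookup τ a Fin.< lookup τ b))

Avoids : ∀ {m k} → Vec (Fin m) m → List (Vec (Fin k) k) → Set
Avoids π E = All (λ τ → ¬ Contains π τ) E

-- H₁ = {1324, 2314, 2413, 3124, 3142, 3214}, written with 0-based values.
H1 : List (Vec (Fin 4) 4)
H1 = (# 0 ∷ # 2 ∷ # 1 ∷ # 3 ∷ [])
   ∷ (# 1 ∷ # 2 ∷ # 0 ∷ # 3 ∷ [])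
   ∷ (# 1 ∷ # 3 ∷ # 0 ∷ # 2 ∷ [])
   ∷ (# 2 ∷ # 0 ∷ # 1 ∷ # 3 ∷ [])
   ∷ (# 2 ∷ # 0 ∷ # 3 ∷ # 1 ∷ [])
   ∷ (# 2 ∷ # 1 ∷ # 0 ∷ # 3 ∷ [])
   ∷ []

SH1 : ℕ → Set
SH1 m = Σ (Vec (Fin m) m) λ π → IsPerm π × Avoids π H1

-- Both sides are sequences of blocks carrying binary trees.  A word 0 ω₂ ⋯ ωₙ of F_n^{1,3}
-- is cut before each letter at most 1 into plain pieces 1·u and descent pieces 0 1 2·u′,
-- where u, u′ have letters at least 2 rising by at most one at a time; such level words
-- are the preorder depths of binary trees (a node of level k has its left subtree at level
-- k + 1 and its right subtree at level k).  On the other side every pattern of H₁ is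
-- skew-indecomposable, and the patterns 2314, 2413, 3124, 3214 and 3142 force an
-- H₁-avoider to be a skew sum of blocks 1 ⊕ σ and 21 ⊕ σ′, where 1324 makes σ, σ′ avoid
-- 213; a 213-avoider c·(larger)·(smaller) is again a binary tree.  Matching plain pieces
-- with 1 ⊕ σ and descent pieces with 21 ⊕ σ′ on the same trees gives the bijection, with
-- both sizes equal to the number of letters after the initial 0.

module Submission where

open import Defs

open import Data.Nat using (ℕ; zero; suc; _+_; _∸_; _≤_; _<_; z≤n; s≤s; z<s)
open import Data.Nat.Properties
open import Data.Empty using (⊥; ⊥-elim)
open import Data.Fin as Fin using (Fin; zero; suc; toℕ; #_)
open import Data.Fin.Properties using (toℕ<n; toℕ-injective; toℕ-fromℕ<)
import Data.Fin.Properties as Finₚ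
open import Data.Vec using (Vec; []; _∷_; lookup; toList; fromList; cast)
open import Data.Vec.Properties using (toList-injective; toList-cast; toList∘fromList; cast-is-id; length-toList)
open import Data.List as List using (List; []; _∷_; _++_; length; head; takeWhile; dropWhile; applyUpTo; filter; concatMap)
open import Data.List.Properties using (map-injective; tabulate-cong; length-applyUpTo; length-upTo; length-++; ++-assoc; filter-notAll; takeWhile++dropWhile)
open import Data.List.Membership.Propositional using (_∈_)
open import Data.List.Membership.Propositional.Properties using (∈-++⁻; ∈-++⁺ʳ; ∈-applyUpTo⁺; ∈-applyUpTo⁻; ∈-upTo⁺; ∈-filter⁺)
open import Data.List.Membership.DecPropositional _≟_ using (_∈?_)
open import Data.List.Relation.Unary.All as All using (All; []; _∷_)
open import Data.List.Relation.Unary.All.Properties using (¬Any⇒All¬; ++⁺; ++⁻; ++⁻ʳ; all-takeWhile; all-head-dropWhile; dropWhile⁺)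
open import Data.List.Relation.Unary.Any as Any using (here; there)
open import Data.List.Relation.Unary.Unique.Propositional using (Unique; []; _∷_)
open import Data.List.Relation.Unary.Unique.Propositional.Properties as Unique using (applyUpTo⁺₁)
open import Data.List.Relation.Binary.Disjoint.Propositional using (Disjoint)
open import Data.List.Relation.Binary.Sublist.Propositional using (_⊆_; []; _∷_; _∷ʳ_; ⊆-refl; ⊆-trans; from∈; minimum)
open import Data.List.Relation.Binary.Sublist.Propositional.Properties using (All-resp-⊆; length-mono-≤; takeWhile-⊆; dropWhile-⊆; ++⁺ˡ; ++⁺ʳ)
open import Data.Maybe.Relation.Unary.All as Maybe using (just; nothing)
open import Data.Product using (Σ; ∃; ∃₂; _×_; _,_; proj₁; proj₂)
open import Function using (_∘_; _$_; id; case_of_)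
open import Function.Bundles using (_⇔_; mk⇔; Equivalence)
open import Data.Sum using (_⊎_; inj₁; inj₂; [_,_]′)
open import Level using (Level)
open import Relation.Binary.PropositionalEquality
open import Relation.Binary.Definitions using (tri<; tri≈; tri>)
open import Relation.Nullary using (¬_; ¬?; Dec; yes; no; contradiction)
open import Relation.Nullary.Decidable using (dec-true; True; toWitness)
open import Relation.Unary using (Pred; Decidable; ∁)

module _ {a p : Level} {A : Set a} {P : Pred A p} (P? : Decidable P) where

  takeWhile-++ : ∀ {xs ys} → All P xs → Maybe.All (∁ P) (head ys) → takeWhile P? (xs ++ ys) ≡ xs
  takeWhile-++ {ys = []} [] nothing = refl
  takeWhile-++ {ys = y ∷ _} [] (just ¬py) with P? y
  ... | yes py = ⊥-elim (¬py py)
  ... | no _ = refl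
  takeWhile-++ (px ∷ pxs) h rewrite dec-true (P? _) px = cong (_ ∷_) (takeWhile-++ pxs h)

  dropWhile-++ : ∀ {xs ys} → All P xs → Maybe.All (∁ P) (head ys) → dropWhile P? (xs ++ ys) ≡ ys
  dropWhile-++ {ys = []} [] nothing = refl
  dropWhile-++ {ys = y ∷ _} [] (just ¬py) with P? y
  ... | yes py = ⊥-elim (¬py py)
  ... | no _ = refl
  dropWhile-++ (px ∷ pxs) h rewrite dec-true (P? _) px = dropWhile-++ pxs h

  length-takeWhile≤ : ∀ xs → length (takeWhile P? xs) ≤ length xs
  length-takeWhile≤ xs = length-mono-≤ (takeWhile-⊆ P? xs)

  length-dropWhile≤ : ∀ xs → length (dropWhile P? xs) ≤ length xs
  length-dropWhile≤ xs = length-mono-≤ (dropWhile-⊆ P? xs)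

  ∈-takeWhile⊎dropWhile : ∀ {x} xs → x ∈ xs → x ∈ takeWhile P? xs ⊎ x ∈ dropWhile P? xs
  ∈-takeWhile⊎dropWhile xs x∈xs =
    ∈-++⁻ (takeWhile P? xs) (subst (_ ∈_) (sym (takeWhile++dropWhile P? xs)) x∈xs)

module _ {a : Level} {A : Set a} where

  split-⊆-++ : ∀ {zs : List A} xs ys → zs ⊆ xs ++ ys →
               ∃₂ λ zs₁ zs₂ → zs ≡ zs₁ ++ zs₂ × zs₁ ⊆ xs × zs₂ ⊆ ys
  split-⊆-++ {zs} [] ys o = [] , zs , refl , [] , o
  split-⊆-++ (x ∷ xs) ys (.x ∷ʳ o) with split-⊆-++ xs ys o
  ... | zs₁ , zs₂ , refl , o₁ , o₂ = zs₁ , zs₂ , refl , x ∷ʳ o₁ , o₂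
  split-⊆-++ (x ∷ xs) ys (refl ∷ o) with split-⊆-++ xs ys o
  ... | zs₁ , zs₂ , refl , o₁ , o₂ = x ∷ zs₁ , zs₂ , refl , refl ∷ o₁ , o₂

  Unique-resp-⊆ : ∀ {xs ys : List A} → xs ⊆ ys → Unique ys → Unique xs
  Unique-resp-⊆ [] [] = []
  Unique-resp-⊆ (_ ∷ʳ o) (_ ∷ u) = Unique-resp-⊆ o u
  Unique-resp-⊆ (refl ∷ o) (x≢ ∷ u) = All-resp-⊆ o x≢ ∷ Unique-resp-⊆ o u

All-head : ∀ {a p} {A : Set a} {P : Pred A p} {xs} → All P xs → Maybe.All P (head xs)
All-head [] = nothing
All-head (px ∷ _) = just px

head-≯ : ∀ {c xs} → All (_< c) xs → Maybe.All (∁ (c <_)) (head xs)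
head-≯ below = Maybe.map <⇒≯ (All-head below)

separated⇒disjoint : ∀ {m xs ys} → All (m ≤_) xs → All (_< m) ys → Disjoint xs ys
separated⇒disjoint high low (v∈xs , v∈ys) = <⇒≱ (All.lookup low v∈ys) (All.lookup high v∈xs)

unique-⊆-length : ∀ {xs ys : List ℕ} → Unique xs → (∀ {z} → z ∈ xs → z ∈ ys) →
                  length xs ≤ length ys
unique-⊆-length {[]} _ _ = z≤n
unique-⊆-length {x ∷ xs} {ys} (x≢xs ∷ u) sub = begin-strict
  length xs             ≤⟨ unique-⊆-length u (λ z∈xs → ∈-filter⁺ x≢? (sub (there z∈xs)) (All.lookup x≢xs z∈xs)) ⟩
  length (filter x≢? ys) <⟨ filter-notAll x≢? ys (Any.map (λ x≡z x≢z → x≢z x≡z) (sub (here refl))) ⟩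
  length ys             ∎
  where
  open ≤-Reasoning
  x≢? = λ y → ¬? (x ≟ y)

unique-⊆-complete : ∀ {xs ys : List ℕ} → Unique xs → (∀ {z} → z ∈ xs → z ∈ ys) →
                    length ys ≤ length xs → ∀ {z} → z ∈ ys → z ∈ xs
unique-⊆-complete {xs} u sub ys≤xs {z} z∈ys with z ∈? xs
... | yes z∈xs = z∈xs
... | no z∉xs = contradiction ys≤xs (<⇒≱ (unique-⊆-length (¬Any⇒All¬ xs z∉xs ∷ u) λ
        { (here refl) → z∈ys ; (there w∈xs) → sub w∈xs }))

InRange : ℕ → ℕ → ℕ → Set
InRange lo hi x = lo ≤ x × x < hi

InRange-mono : ∀ {lo hi lo′ hi′} → lo′ ≤ lo → hi ≤ hi′ → ∀ {x} → InRange lo hi x → InRange lo′ hi′ x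
InRange-mono lo′≤lo hi≤hi′ (lo≤x , x<hi) = ≤-trans lo′≤lo lo≤x , <-≤-trans x<hi hi≤hi′

range : ℕ → ℕ → List ℕ
range lo k = applyUpTo (lo +_) k

∈-range⁻ : ∀ lo k {x} → x ∈ range lo k → InRange lo (lo + k) x
∈-range⁻ lo k x∈ with i , i<k , refl ← ∈-applyUpTo⁻ (lo +_) x∈ = m≤m+n lo i , +-monoʳ-< lo i<k

∈-range⁺ : ∀ lo k {x} → InRange lo (lo + k) x → x ∈ range lo k
∈-range⁺ lo k (lo≤x , x<lo+k) = subst (_∈ range lo k) (m+[n∸m]≡n lo≤x)
  (∈-applyUpTo⁺ (lo +_) (subst (_ <_) (m+n∸m≡n lo k) (∸-monoˡ-< x<lo+k lo≤x)))

range-unique : ∀ lo k → Unique (range lo k)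
range-unique lo k = applyUpTo⁺₁ (lo +_) k (λ i<j _ → <⇒≢ (+-monoʳ-< lo i<j))

record IsRangePerm (lo hi : ℕ) (xs : List ℕ) : Set where
  field
    unique   : Unique xs
    bounded  : All (InRange lo hi) xs
    complete : ∀ {x} → lo ≤ x → x < hi → x ∈ xs

length-rangePerm : ∀ {lo hi xs} → IsRangePerm lo hi xs → lo ≤ hi → lo + length xs ≡ hi
length-rangePerm {lo} {hi} {xs} rp lo≤hi = begin
  lo + length xs           ≡⟨ cong (lo +_) (≤-antisym (unique-⊆-length unique xs⊆range)
                                                      (unique-⊆-length (range-unique lo k) range⊆xs)) ⟩
  lo + length (range lo k) ≡⟨ cong (lo +_) (length-applyUpTo (lo +_) k) ⟩
  lo + k                   ≡⟨ lo+k≡hi ⟩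
  hi                       ∎
  where
  open ≡-Reasoning
  open IsRangePerm rp
  k = hi ∸ lo
  lo+k≡hi = m+[n∸m]≡n lo≤hi
  xs⊆range : ∀ {x} → x ∈ xs → x ∈ range lo k
  xs⊆range x∈ = ∈-range⁺ lo k (InRange-mono ≤-refl (≤-reflexive (sym lo+k≡hi)) (All.lookup bounded x∈))
  range⊆xs : ∀ {x} → x ∈ range lo k → x ∈ xs
  range⊆xs x∈ = let lo≤x , x<lo+k = ∈-range⁻ lo k x∈ in complete lo≤x (<-≤-trans x<lo+k (≤-reflexive lo+k≡hi))

rangePerm-restrict : ∀ {lo hi zs lo′ hi′ xs} → IsRangePerm lo hi zs → lo ≤ lo′ → hi′ ≤ hi → xs ⊆ zs →
                     All (InRange lo′ hi′) xs → (∀ {x} → x ∈ zs → InRange lo′ hi′ x → x ∈ xs) →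
                     IsRangePerm lo′ hi′ xs
rangePerm-restrict rp lo≤lo′ hi′≤hi xs⊆zs inRange exact = record
  { unique   = Unique-resp-⊆ xs⊆zs unique
  ; bounded  = inRange
  ; complete = λ lo′≤x x<hi′ → exact (complete (≤-trans lo≤lo′ lo′≤x) (<-≤-trans x<hi′ hi′≤hi)) (lo′≤x , x<hi′)
  }
  where open IsRangePerm rp

rangePerm-splitAt : ∀ {lo hi c xs} → IsRangePerm lo hi (c ∷ xs) → All (_< c) (dropWhile (c <?_) xs) →
                    IsRangePerm (suc c) hi (takeWhile (c <?_) xs) × IsRangePerm lo c (dropWhile (c <?_) xs)
rangePerm-splitAt {lo} {hi} {c} {xs} rp below<c = rp-above , rp-below
  where
  open IsRangePerm rp
  P? = c <?_
  above>c = all-takeWhile P? xs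
  lo≤c = proj₁ (All.head bounded)
  c<hi = proj₂ (All.head bounded)
  rp-above : IsRangePerm (suc c) hi (takeWhile P? xs)
  rp-above = rangePerm-restrict rp (≤-trans lo≤c (n≤1+n c)) ≤-refl (c ∷ʳ takeWhile-⊆ P? xs)
    (All.zipWith (λ (c<x , (_ , x<hi)) → c<x , x<hi)
                 (above>c , All-resp-⊆ (takeWhile-⊆ P? xs) (All.tail bounded)))
    λ { (here refl) (c<c , _) → contradiction c<c (<-irrefl refl)
      ; (there x∈xs) (c<x , _) → [ id , (λ x∈ → contradiction (All.lookup below<c x∈) (<⇒≯ c<x)) ]′
                                   (∈-takeWhile⊎dropWhile P? xs x∈xs) }
  rp-below : IsRangePerm lo c (dropWhile P? xs)
  rp-below = rangePerm-restrict rp ≤-refl (<⇒≤ c<hi) (c ∷ʳ dropWhile-⊆ P? xs)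
    (All.zipWith (λ ((lo≤x , _) , x<c) → lo≤x , x<c)
                 (All-resp-⊆ (dropWhile-⊆ P? xs) (All.tail bounded) , below<c))
    λ { (here refl) (_ , c<c) → contradiction c<c (<-irrefl refl)
      ; (there x∈xs) (_ , x<c) → [ (λ x∈ → contradiction (All.lookup above>c x∈) (<⇒≯ x<c)) , id ]′
                                   (∈-takeWhile⊎dropWhile P? xs x∈xs) }

-- Trees, blocks and words

data Tree : Set where
  leaf : Tree
  node : Tree → Tree → Tree

size : Tree → ℕ
size leaf = 0
size (node l r) = suc (size l + size r)

data Block : Set where
  plain   : Tree → Block
  descent : Tree → Tree → Block

blockSize : Block → ℕ
blockSize (plain t) = suc (size t)
blockSize (descent l r) = 2 + size (node l r)

totalSize : List Block → ℕ
totalSize [] = 0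
totalSize (b ∷ bs) = blockSize b + totalSize bs

levels : ℕ → Tree → List ℕ
levels k leaf = []
levels k (node l r) = k ∷ levels (suc k) l ++ levels k r

blockWord : Block → List ℕ
blockWord (plain t) = 1 ∷ levels 2 t
blockWord (descent l r) = 0 ∷ 1 ∷ levels 2 (node l r)

blocksWord : List Block → List ℕ
blocksWord = concatMap blockWord

-- The first argument of every decoder is fuel; the round trips only require it to bound the
-- length of the input.
decodeLevels : ℕ → ℕ → List ℕ → Tree
decodeLevels zero k _ = leaf
decodeLevels (suc f) k [] = leaf
decodeLevels (suc f) k (_ ∷ ws) =
  node (decodeLevels f (suc k) (takeWhile (k <?_) ws)) (decodeLevels f k (dropWhile (k <?_) ws))

-- The tree of a descent block is nonempty on every word of F13; `leaf` is a junk case.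
descentBlock : Tree → Block
descentBlock leaf = plain leaf
descentBlock (node l r) = descent l r

decodeBlocks : ℕ → List ℕ → List Block
decodeBlocks zero _ = []
decodeBlocks (suc f) (1 ∷ ws) =
  plain (decodeLevels f 2 (takeWhile (1 <?_) ws)) ∷ decodeBlocks f (dropWhile (1 <?_) ws)
decodeBlocks (suc f) (0 ∷ 1 ∷ ws) =
  descentBlock (decodeLevels f 2 (takeWhile (1 <?_) ws)) ∷ decodeBlocks f (dropWhile (1 <?_) ws)
decodeBlocks (suc f) _ = []

length-levels : ∀ k t → length (levels k t) ≡ size t
length-levels k leaf = refl
length-levels k (node l r) = cong suc (begin
  length (levels (suc k) l ++ levels k r)          ≡⟨ length-++ (levels (suc k) l) ⟩
  length (levels (suc k) l) + length (levels k r)  ≡⟨ cong₂ _+_ (length-levels (suc k) l) (length-levels k r) ⟩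
  size l + size r                                  ∎)
  where open ≡-Reasoning

length-blocksWord : ∀ bs → length (blocksWord bs) ≡ totalSize bs
length-blocksWord [] = refl
length-blocksWord (b ∷ bs) = begin
  length (blockWord b ++ blocksWord bs)          ≡⟨ length-++ (blockWord b) ⟩
  length (blockWord b) + length (blocksWord bs)  ≡⟨ cong₂ _+_ (length-blockWord b) (length-blocksWord bs) ⟩
  blockSize b + totalSize bs                     ∎
  where
  open ≡-Reasoning
  length-blockWord : ∀ b → length (blockWord b) ≡ blockSize b
  length-blockWord (plain t) = cong suc (length-levels 2 t)
  length-blockWord (descent l r) = cong (2 +_) (length-levels 2 (node l r))

levels-≥ : ∀ k t → All (k ≤_) (levels k t)
levels-≥ k leaf = []
levels-≥ k (node l r) = ≤-refl ∷ ++⁺ (All.map <⇒≤ (levels-≥ (suc k) l)) (levels-≥ k r)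

levels-head : ∀ k t → Maybe.All (∁ (k <_)) (head (levels k t))
levels-head k leaf = nothing
levels-head k (node l r) = just (<-irrefl refl)

decodeLevels-levels : ∀ f k t → size t ≤ f → decodeLevels f k (levels k t) ≡ t
decodeLevels-levels zero k leaf _ = refl
decodeLevels-levels (suc f) k leaf _ = refl
decodeLevels-levels (suc f) k (node l r) (s≤s t≤f)
  rewrite takeWhile-++ (k <?_) (levels-≥ (suc k) l) (levels-head k r)
        | dropWhile-++ (k <?_) (levels-≥ (suc k) l) (levels-head k r)
  = cong₂ node (decodeLevels-levels f (suc k) l (m+n≤o⇒m≤o (size l) t≤f))
               (decodeLevels-levels f k r (m+n≤o⇒n≤o (size l) t≤f))

blocksWord-head : ∀ bs → Maybe.All (∁ (1 <_)) (head (blocksWord bs))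
blocksWord-head [] = nothing
blocksWord-head (plain _ ∷ _) = just (<-irrefl refl)
blocksWord-head (descent _ _ ∷ _) = just λ ()

decodeBlocks-blocksWord : ∀ f bs → totalSize bs ≤ f → decodeBlocks f (blocksWord bs) ≡ bs
decodeBlocks-blocksWord zero [] _ = refl
decodeBlocks-blocksWord zero (plain _ ∷ _) ()
decodeBlocks-blocksWord zero (descent _ _ ∷ _) ()
decodeBlocks-blocksWord (suc f) [] _ = refl
decodeBlocks-blocksWord (suc f) (plain t ∷ bs) (s≤s le)
  rewrite takeWhile-++ (1 <?_) (levels-≥ 2 t) (blocksWord-head bs)
        | dropWhile-++ (1 <?_) (levels-≥ 2 t) (blocksWord-head bs)
  = cong₂ _∷_ (cong plain (decodeLevels-levels f 2 t (m+n≤o⇒m≤o (size t) le)))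
              (decodeBlocks-blocksWord f bs (m+n≤o⇒n≤o (size t) le))
decodeBlocks-blocksWord (suc f) (descent l r ∷ bs) (s≤s le)
  rewrite takeWhile-++ (1 <?_) (levels-≥ 2 (node l r)) (blocksWord-head bs)
        | dropWhile-++ (1 <?_) (levels-≥ 2 (node l r)) (blocksWord-head bs)
        | decodeLevels-levels f 2 (node l r) (m+n≤o⇒m≤o (size (node l r)) (m+n≤o⇒n≤o 1 le))
  = cong (descent l r ∷_) (decodeBlocks-blocksWord f bs (m+n≤o⇒n≤o (size (node l r)) (m+n≤o⇒n≤o 1 le)))

data Steps : ℕ → List ℕ → Set where
  []  : ∀ {p} → Steps p []
  _∷_ : ∀ {p x ws} → x ≤ suc p → Steps x ws → Steps p (x ∷ ws)

Opens12 : List ℕ → Set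
Opens12 ws = ∃ λ ws′ → ws ≡ 1 ∷ 2 ∷ ws′

data ZeroRule : List ℕ → Set where
  []  : ZeroRule []
  _∷_ : ∀ {x ws} → (x ≡ 0 → Opens12 ws) → ZeroRule ws → ZeroRule (x ∷ ws)

StepsFrom : ℕ → List ℕ → Set
StepsFrom h ws = ∀ {q} → h ≤ suc q → Steps q ws

Steps-++⁻ˡ : ∀ {p} xs {ys} → Steps p (xs ++ ys) → Steps p xs
Steps-++⁻ˡ [] _ = []
Steps-++⁻ˡ (x ∷ xs) (x≤ ∷ s) = x≤ ∷ Steps-++⁻ˡ xs s

Steps-++⁻ʳ : ∀ {p} xs {ys} → Steps p (xs ++ ys) → ∃ λ q → Steps q ys
Steps-++⁻ʳ [] s = _ , s
Steps-++⁻ʳ (x ∷ xs) (_ ∷ s) = Steps-++⁻ʳ xs s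

Steps-rebase : ∀ {p q ws} → Steps p ws → Maybe.All (_≤ suc q) (head ws) → Steps q ws
Steps-rebase [] _ = []
Steps-rebase (_ ∷ s) (just x≤) = x≤ ∷ s

ZeroRule-++⁻ʳ : ∀ xs {ys} → ZeroRule (xs ++ ys) → ZeroRule ys
ZeroRule-++⁻ʳ [] z = z
ZeroRule-++⁻ʳ (x ∷ xs) (_ ∷ z) = ZeroRule-++⁻ʳ xs z

ZeroRule-++⁺ : ∀ {xs ys} → All (0 <_) xs → ZeroRule ys → ZeroRule (xs ++ ys)
ZeroRule-++⁺ [] z = z
ZeroRule-++⁺ (0<x ∷ pos) z = (λ { refl → contradiction 0<x (<-irrefl refl) }) ∷ ZeroRule-++⁺ pos z

steps-levels : ∀ k t {h ys} → h ≤ k → StepsFrom h ys → StepsFrom k (levels k t ++ ys)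
steps-levels k leaf h≤k s k≤ = s (≤-trans h≤k k≤)
steps-levels k (node l r) {ys = ys} h≤k s k≤ =
  k≤ ∷ subst (Steps k) (sym (++-assoc (levels (suc k) l) (levels k r) ys))
             (steps-levels (suc k) l (n≤1+n k) (steps-levels k r h≤k s) ≤-refl)

steps-blocksWord : ∀ bs → StepsFrom 1 (blocksWord bs)
steps-blocksWord [] _ = []
steps-blocksWord (plain t ∷ bs) 1≤ =
  1≤ ∷ steps-levels 2 t (s≤s z≤n) (steps-blocksWord bs) ≤-refl
steps-blocksWord (descent l r ∷ bs) _ =
  z≤n ∷ ≤-refl ∷ steps-levels 2 (node l r) (s≤s z≤n) (steps-blocksWord bs) ≤-refl

zeroRule-blocksWord : ∀ bs → ZeroRule (blocksWord bs)
zeroRule-blocksWord [] = []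
zeroRule-blocksWord (plain t ∷ bs) =
  (λ ()) ∷ ZeroRule-++⁺ (All.map (≤-trans (s≤s z≤n)) (levels-≥ 2 t)) (zeroRule-blocksWord bs)
zeroRule-blocksWord (descent l r ∷ bs) =
  (λ _ → _ , refl) ∷ (λ ()) ∷
  ZeroRule-++⁺ (All.map (≤-trans (s≤s z≤n)) (levels-≥ 2 (node l r))) (zeroRule-blocksWord bs)

Steps-span : ∀ k ws → Steps (suc k) ws →
             Steps (suc k) (takeWhile (suc k <?_) ws) × Steps k (dropWhile (suc k <?_) ws)
Steps-span k ws s =
  Steps-++⁻ˡ ws₁ s′ , Steps-rebase (proj₂ (Steps-++⁻ʳ ws₁ s′)) (Maybe.map ≮⇒≥ (all-head-dropWhile P? ws))
  where
  P? = suc k <?_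
  ws₁ = takeWhile P? ws
  s′ : Steps (suc k) (ws₁ ++ dropWhile P? ws)
  s′ = subst (Steps (suc k)) (sym (takeWhile++dropWhile P? ws)) s

levels-decodeLevels : ∀ f k ws → Steps k ws → All (suc k ≤_) ws → length ws ≤ f →
                      levels (suc k) (decodeLevels f (suc k) ws) ≡ ws
levels-decodeLevels zero k [] _ _ _ = refl
levels-decodeLevels (suc f) k [] _ _ _ = refl
levels-decodeLevels (suc f) k (x ∷ ws) (x≤ ∷ s) (k<x ∷ above) (s≤s le) with ≤-antisym x≤ k<x
... | refl = cong (suc k ∷_) (begin
  levels (suc (suc k)) (decodeLevels f (suc (suc k)) ws₁) ++ levels (suc k) (decodeLevels f (suc k) ws₂)
    ≡⟨ cong₂ _++_ (levels-decodeLevels f (suc k) ws₁ (proj₁ (Steps-span k ws s)) (all-takeWhile P? ws)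
                                       (≤-trans (length-takeWhile≤ P? ws) le))
                  (levels-decodeLevels f k ws₂ (proj₂ (Steps-span k ws s)) (dropWhile⁺ P? above)
                                       (≤-trans (length-dropWhile≤ P? ws) le)) ⟩
  ws₁ ++ ws₂
    ≡⟨ takeWhile++dropWhile P? ws ⟩
  ws ∎)
  where
  open ≡-Reasoning
  P? = suc k <?_
  ws₁ = takeWhile P? ws
  ws₂ = dropWhile P? ws

mutual
  blocksWord-decodeBlocks : ∀ f ws → Steps 0 ws → ZeroRule ws → length ws ≤ f →
                            blocksWord (decodeBlocks f ws) ≡ ws
  blocksWord-decodeBlocks zero [] _ _ _ = refl
  blocksWord-decodeBlocks (suc f) [] _ _ _ = refl
  blocksWord-decodeBlocks (suc f) (1 ∷ ws) (_ ∷ s) (_ ∷ z) (s≤s le) =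
    cong (1 ∷_) (blockBody-decode f ws s z le)
  blocksWord-decodeBlocks (suc f) (0 ∷ ws) (_ ∷ _) (opens ∷ _) _ with opens refl
  blocksWord-decodeBlocks (suc (suc f)) (0 ∷ 1 ∷ 2 ∷ ws) (_ ∷ _ ∷ s) (_ ∷ _ ∷ z) (s≤s (s≤s le)) | _ , refl =
    cong (λ u → 0 ∷ 1 ∷ u) (blockBody-decode (suc f) (2 ∷ ws) s z (m≤n⇒m≤1+n le))
  blocksWord-decodeBlocks (suc zero) (0 ∷ 1 ∷ 2 ∷ _) _ _ (s≤s ()) | _ , refl
  blocksWord-decodeBlocks (suc f) (suc (suc _) ∷ _) (s≤s () ∷ _) _ _

  blockBody-decode : ∀ f ws → Steps 1 ws → ZeroRule ws → length ws ≤ f →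
                     levels 2 (decodeLevels f 2 (takeWhile (1 <?_) ws)) ++
                     blocksWord (decodeBlocks f (dropWhile (1 <?_) ws)) ≡ ws
  blockBody-decode f ws s z le = begin
    levels 2 (decodeLevels f 2 ws₁) ++ blocksWord (decodeBlocks f ws₂)
      ≡⟨ cong₂ _++_ (levels-decodeLevels f 1 ws₁ (proj₁ (Steps-span 0 ws s)) (all-takeWhile P? ws)
                                         (≤-trans (length-takeWhile≤ P? ws) le))
                    (blocksWord-decodeBlocks f ws₂ (proj₂ (Steps-span 0 ws s)) (ZeroRule-++⁻ʳ ws₁ z′)
                                             (≤-trans (length-dropWhile≤ P? ws) le)) ⟩
    ws₁ ++ ws₂
      ≡⟨ takeWhile++dropWhile P? ws ⟩
    ws ∎
    where
    open ≡-Reasoning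
    P? = 1 <?_
    ws₁ = takeWhile P? ws
    ws₂ = dropWhile P? ws
    z′ : ZeroRule (ws₁ ++ ws₂)
    z′ = subst ZeroRule (sym (takeWhile++dropWhile P? ws)) z

-- Permutations from blocks

treePerm : ℕ → Tree → List ℕ
treePerm lo leaf = []
treePerm lo (node l r) = lo + size r ∷ treePerm (suc (lo + size r)) l ++ treePerm lo r

blockPerm : ℕ → Block → List ℕ
blockPerm b (plain t) = b ∷ treePerm (suc b) t
blockPerm b (descent l r) = suc b ∷ b ∷ treePerm (suc (suc b)) (node l r)

blocksPerm : ℕ → List Block → List ℕ
blocksPerm lo [] = []
blocksPerm lo (b ∷ bs) = blockPerm (lo + totalSize bs) b ++ blocksPerm lo bs

decodeTree : ℕ → List ℕ → Tree
decodeTree zero _ = leaf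
decodeTree (suc f) [] = leaf
decodeTree (suc f) (c ∷ xs) = node (decodeTree f (takeWhile (c <?_) xs)) (decodeTree f (dropWhile (c <?_) xs))

data DescentStart (a : ℕ) : List ℕ → Set where
  descentStart : ∀ {y c xs} → y < a → a < c → DescentStart a (y ∷ c ∷ xs)

descentStart? : ∀ a xs → Dec (DescentStart a xs)
descentStart? a (y ∷ c ∷ xs) with y <? a | a <? c
... | yes y<a | yes a<c = yes (descentStart y<a a<c)
... | no y≮a  | _       = no λ { (descentStart y<a _) → y≮a y<a }
... | _       | no a≮c  = no λ { (descentStart _ a<c) → a≮c a<c }
descentStart? a [] = no λ ()
descentStart? a (_ ∷ []) = no λ ()

decodeBlocksPerm : ℕ → List ℕ → List Block
decodeBlocksPerm zero _ = []
decodeBlocksPerm (suc f) [] = []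
decodeBlocksPerm (suc f) (a ∷ xs) with descentStart? a xs
... | yes (descentStart {y} {c} {ys} _ _) =
  descent (decodeTree f (takeWhile (c <?_) τ)) (decodeTree f (dropWhile (c <?_) τ))
    ∷ decodeBlocksPerm f (dropWhile (a <?_) ys)
  where τ = takeWhile (a <?_) ys
... | no _ = plain (decodeTree f (takeWhile (a <?_) xs)) ∷ decodeBlocksPerm f (dropWhile (a <?_) xs)

length-treePerm : ∀ lo t → length (treePerm lo t) ≡ size t
length-treePerm lo leaf = refl
length-treePerm lo (node l r) = cong suc (begin
  length (treePerm _ l ++ treePerm lo r)          ≡⟨ length-++ (treePerm _ l) ⟩
  length (treePerm _ l) + length (treePerm lo r)  ≡⟨ cong₂ _+_ (length-treePerm _ l) (length-treePerm lo r) ⟩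
  size l + size r                                 ∎)
  where open ≡-Reasoning

length-blocksPerm : ∀ lo bs → length (blocksPerm lo bs) ≡ totalSize bs
length-blocksPerm lo [] = refl
length-blocksPerm lo (b ∷ bs) = begin
  length (blockPerm _ b ++ blocksPerm lo bs)          ≡⟨ length-++ (blockPerm _ b) ⟩
  length (blockPerm _ b) + length (blocksPerm lo bs)  ≡⟨ cong₂ _+_ (length-blockPerm b) (length-blocksPerm lo bs) ⟩
  blockSize b + totalSize bs                          ∎
  where
  open ≡-Reasoning
  length-blockPerm : ∀ {x} b → length (blockPerm x b) ≡ blockSize b
  length-blockPerm (plain t) = cong suc (length-treePerm _ t)
  length-blockPerm (descent l r) = cong (2 +_) (length-treePerm _ (node l r))

treePerm-inRange : ∀ lo t → All (InRange lo (lo + size t)) (treePerm lo t)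
treePerm-inRange lo leaf = []
treePerm-inRange lo (node l r) =
  (m≤m+n lo (size r) , subst (c <_) c+1+l≡lo+t (m≤m+n (suc c) (size l)))
  ∷ ++⁺ (All.map (InRange-mono (≤-trans (m≤m+n lo (size r)) (n≤1+n c)) (≤-reflexive c+1+l≡lo+t))
                 (treePerm-inRange (suc c) l))
        (All.map (InRange-mono ≤-refl (+-monoʳ-≤ lo (≤-trans (m≤n+m (size r) (size l)) (n≤1+n _))))
                 (treePerm-inRange lo r))
  where
  c = lo + size r
  c+1+l≡lo+t : suc c + size l ≡ lo + size (node l r)
  c+1+l≡lo+t = begin
    suc (lo + size r + size l) ≡⟨ cong suc (+-assoc lo (size r) (size l)) ⟩
    suc (lo + (size r + size l)) ≡⟨ sym (+-suc lo _) ⟩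
    lo + suc (size r + size l) ≡⟨ cong (λ s → lo + suc s) (+-comm (size r) (size l)) ⟩
    lo + size (node l r) ∎
    where open ≡-Reasoning

blockPerm-inRange : ∀ b c → All (InRange b (b + blockSize c)) (blockPerm b c)
blockPerm-inRange b (plain t) =
  (≤-refl , m<m+n b z<s)
  ∷ All.map (InRange-mono (n≤1+n b) (≤-reflexive (sym (+-suc b (size t))))) (treePerm-inRange (suc b) t)
blockPerm-inRange b (descent l r) =
  (n≤1+n b , b+1<hi) ∷ (≤-refl , <-trans (n<1+n b) b+1<hi)
  ∷ All.map (InRange-mono (≤-trans (n≤1+n b) (n≤1+n _)) (≤-reflexive 2+b+s≡b+2+s))
            (treePerm-inRange (suc (suc b)) (node l r))
  where
  s = size (node l r)
  2+b+s≡b+2+s : suc (suc b) + s ≡ b + suc (suc s)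
  2+b+s≡b+2+s = sym (trans (+-suc b (suc s)) (cong suc (+-suc b s)))
  b+1<hi : suc b < b + suc (suc s)
  b+1<hi = subst (suc b <_) 2+b+s≡b+2+s (s≤s (s≤s (m≤m+n b s)))

blocksPerm-inRange : ∀ lo bs → All (InRange lo (lo + totalSize bs)) (blocksPerm lo bs)
blocksPerm-inRange lo [] = []
blocksPerm-inRange lo (b ∷ bs) =
  ++⁺ (All.map (InRange-mono (m≤m+n lo T) (≤-reflexive (trans (+-assoc lo T _) (cong (lo +_) (+-comm T _)))))
               (blockPerm-inRange (lo + T) b))
      (All.map (InRange-mono ≤-refl (+-monoʳ-≤ lo (m≤n+m T (blockSize b)))) (blocksPerm-inRange lo bs))
  where T = totalSize bs

decodeTree-treePerm : ∀ f lo t → size t ≤ f → decodeTree f (treePerm lo t) ≡ t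
decodeTree-treePerm zero lo leaf _ = refl
decodeTree-treePerm (suc f) lo leaf _ = refl
decodeTree-treePerm (suc f) lo (node l r) (s≤s t≤f) = begin
  node (decodeTree f (takeWhile (c <?_) (L ++ R))) (decodeTree f (dropWhile (c <?_) (L ++ R)))
    ≡⟨ cong₂ (λ xs ys → node (decodeTree f xs) (decodeTree f ys))
             (takeWhile-++ (c <?_) above below) (dropWhile-++ (c <?_) above below) ⟩
  node (decodeTree f L) (decodeTree f R)
    ≡⟨ cong₂ node (decodeTree-treePerm f (suc c) l (m+n≤o⇒m≤o (size l) t≤f))
                  (decodeTree-treePerm f lo r (m+n≤o⇒n≤o (size l) t≤f)) ⟩
  node l r ∎
  where
  open ≡-Reasoning
  c = lo + size r
  L = treePerm (suc c) l
  R = treePerm lo r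
  above = All.map proj₁ (treePerm-inRange (suc c) l)
  below = head-≯ (All.map proj₂ (treePerm-inRange lo r))

descentStart-head : ∀ {a y xs} → DescentStart a (y ∷ xs) → y < a
descentStart-head (descentStart y<a _) = y<a

¬DescentStart-plain : ∀ {b} xs {ys} → All (b <_) xs → All (_< b) ys → ¬ DescentStart b (xs ++ ys)
¬DescentStart-plain [] [] (_ ∷ c<b ∷ _) (descentStart _ b<c) = <-asym b<c c<b
¬DescentStart-plain (_ ∷ _) (b<x ∷ _) _ d = <-asym (descentStart-head d) b<x

decodeBlocksPerm-plain : ∀ f b xs ys → All (b <_) xs → All (_< b) ys →
  decodeBlocksPerm (suc f) (b ∷ xs ++ ys) ≡ plain (decodeTree f xs) ∷ decodeBlocksPerm f ys
decodeBlocksPerm-plain f b xs ys above below with descentStart? b (xs ++ ys)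
... | yes d = contradiction d (¬DescentStart-plain xs above below)
... | no _ = cong₂ (λ us vs → plain (decodeTree f us) ∷ decodeBlocksPerm f vs)
                   (takeWhile-++ (b <?_) above (head-≯ below)) (dropWhile-++ (b <?_) above (head-≯ below))

decodeBlocksPerm-descent : ∀ f a y c xs ys zs → y < a → a < c → All (c <_) xs → All (InRange (suc a) c) ys →
  All (_< a) zs →
  decodeBlocksPerm (suc f) (a ∷ y ∷ c ∷ (xs ++ ys) ++ zs) ≡
  descent (decodeTree f xs) (decodeTree f ys) ∷ decodeBlocksPerm f zs
decodeBlocksPerm-descent f a y c xs ys zs y<a a<c above between below
  with descentStart? a (y ∷ c ∷ (xs ++ ys) ++ zs)
... | no ¬d = contradiction (descentStart y<a a<c) ¬d
... | yes (descentStart _ _) = trans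
  (cong₂ (λ τ us → descent (decodeTree f (takeWhile (c <?_) τ)) (decodeTree f (dropWhile (c <?_) τ))
                     ∷ decodeBlocksPerm f us)
         (takeWhile-++ (a <?_) xs++ys>a (head-≯ below)) (dropWhile-++ (a <?_) xs++ys>a (head-≯ below)))
  (cong₂ (λ us vs → descent (decodeTree f us) (decodeTree f vs) ∷ decodeBlocksPerm f zs)
         (takeWhile-++ (c <?_) above ys≯c) (dropWhile-++ (c <?_) above ys≯c))
  where
  xs++ys>a : All (a <_) (xs ++ ys)
  xs++ys>a = ++⁺ (All.map (<-trans a<c) above) (All.map proj₁ between)
  ys≯c = head-≯ (All.map proj₂ between)

decodeBlocksPerm-blocksPerm : ∀ f lo bs → totalSize bs ≤ f → decodeBlocksPerm f (blocksPerm lo bs) ≡ bs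
decodeBlocksPerm-blocksPerm zero lo [] _ = refl
decodeBlocksPerm-blocksPerm (suc f) lo [] _ = refl
decodeBlocksPerm-blocksPerm zero lo (plain _ ∷ _) ()
decodeBlocksPerm-blocksPerm zero lo (descent _ _ ∷ _) ()
decodeBlocksPerm-blocksPerm (suc f) lo (plain t ∷ bs) (s≤s le) = begin
  decodeBlocksPerm (suc f) (b ∷ treePerm (suc b) t ++ blocksPerm lo bs)
    ≡⟨ decodeBlocksPerm-plain f b _ _ (All.map proj₁ (treePerm-inRange (suc b) t))
                                      (All.map proj₂ (blocksPerm-inRange lo bs)) ⟩
  plain (decodeTree f (treePerm (suc b) t)) ∷ decodeBlocksPerm f (blocksPerm lo bs)
    ≡⟨ cong₂ _∷_ (cong plain (decodeTree-treePerm f (suc b) t (m+n≤o⇒m≤o (size t) le)))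
                 (decodeBlocksPerm-blocksPerm f lo bs (m+n≤o⇒n≤o (size t) le)) ⟩
  plain t ∷ bs ∎
  where
  open ≡-Reasoning
  b = lo + totalSize bs
decodeBlocksPerm-blocksPerm (suc f) lo (descent l r ∷ bs) (s≤s le) = begin
  decodeBlocksPerm (suc f) (suc b ∷ b ∷ c ∷ (treePerm (suc c) l ++ treePerm (suc (suc b)) r) ++ blocksPerm lo bs)
    ≡⟨ decodeBlocksPerm-descent f (suc b) b c _ _ _ ≤-refl (s≤s (s≤s (m≤m+n b (size r))))
         (All.map proj₁ (treePerm-inRange (suc c) l)) (treePerm-inRange (suc (suc b)) r)
         (All.map (m<n⇒m<1+n ∘ proj₂) (blocksPerm-inRange lo bs)) ⟩
  descent (decodeTree f (treePerm (suc c) l)) (decodeTree f (treePerm (suc (suc b)) r))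
    ∷ decodeBlocksPerm f (blocksPerm lo bs)
    ≡⟨ cong₂ _∷_ (cong₂ descent (decodeTree-treePerm f (suc c) l (m+n≤o⇒m≤o (size l) lr≤f))
                                (decodeTree-treePerm f (suc (suc b)) r (m+n≤o⇒n≤o (size l) lr≤f)))
                 (decodeBlocksPerm-blocksPerm f lo bs (m+n≤o⇒n≤o (size l + size r) lrT≤f)) ⟩
  descent l r ∷ bs ∎
  where
  open ≡-Reasoning
  b = lo + totalSize bs
  c = suc (suc b) + size r
  lrT≤f = m+n≤o⇒n≤o 2 le
  lr≤f = m+n≤o⇒m≤o (size l + size r) lrT≤f

-- Pattern avoidance

data H1Pattern (x y z w : ℕ) : Set where
  p1324 : x < z → z < y → y < w → H1Pattern x y z w
  p2314 : z < x → x < y → y < w → H1Pattern x y z w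
  p2413 : z < x → x < w → w < y → H1Pattern x y z w
  p3124 : y < z → z < x → x < w → H1Pattern x y z w
  p3142 : y < w → w < x → x < z → H1Pattern x y z w
  p3214 : z < y → y < x → x < w → H1Pattern x y z w

AvoidsH1 : List ℕ → Set
AvoidsH1 xs = ∀ {x y z w} → x ∷ y ∷ z ∷ w ∷ [] ⊆ xs → ¬ H1Pattern x y z w

Avoids213 : List ℕ → Set
Avoids213 xs = ∀ {x y z} → x ∷ y ∷ z ∷ [] ⊆ xs → y < x → x < z → ⊥

AvoidsH1-resp-⊆ : ∀ {xs ys} → xs ⊆ ys → AvoidsH1 ys → AvoidsH1 xs
AvoidsH1-resp-⊆ xs⊆ys av o = av (⊆-trans o xs⊆ys)

Avoids213-resp-⊆ : ∀ {xs ys} → xs ⊆ ys → Avoids213 ys → Avoids213 xs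
Avoids213-resp-⊆ xs⊆ys av o = av (⊆-trans o xs⊆ys)

avoids213⇒avoidsH1 : ∀ {xs} → Avoids213 xs → AvoidsH1 xs
avoids213⇒avoidsH1 av o (p1324 _ z<y y<w) = av (⊆-trans (_ ∷ʳ ⊆-refl) o) z<y y<w
avoids213⇒avoidsH1 av o (p2314 z<x x<y y<w) = av (⊆-trans (refl ∷ _ ∷ʳ ⊆-refl) o) z<x (<-trans x<y y<w)
avoids213⇒avoidsH1 av o (p2413 z<x x<w _) = av (⊆-trans (refl ∷ _ ∷ʳ ⊆-refl) o) z<x x<w
avoids213⇒avoidsH1 av o (p3124 y<z z<x x<w) = av (⊆-trans (refl ∷ refl ∷ _ ∷ʳ ⊆-refl) o) (<-trans y<z z<x) x<w
avoids213⇒avoidsH1 av o (p3142 y<w w<x x<z) = av (⊆-trans (refl ∷ refl ∷ refl ∷ _ ∷ʳ []) o) (<-trans y<w w<x) x<z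
avoids213⇒avoidsH1 av o (p3214 _ y<x x<w) = av (⊆-trans (refl ∷ refl ∷ _ ∷ʳ ⊆-refl) o) y<x x<w

¬H1Pattern-skew₁ : ∀ {x y z w} → y < x → z < x → w < x → ¬ H1Pattern x y z w
¬H1Pattern-skew₁ y<x z<x w<x (p1324 x<z _ _) = <-asym x<z z<x
¬H1Pattern-skew₁ y<x z<x w<x (p2314 _ x<y _) = <-asym x<y y<x
¬H1Pattern-skew₁ y<x z<x w<x (p2413 _ x<w _) = <-asym x<w w<x
¬H1Pattern-skew₁ y<x z<x w<x (p3124 _ _ x<w) = <-asym x<w w<x
¬H1Pattern-skew₁ y<x z<x w<x (p3142 _ _ x<z) = <-asym x<z z<x
¬H1Pattern-skew₁ y<x z<x w<x (p3214 _ _ x<w) = <-asym x<w w<x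

¬H1Pattern-skew₂ : ∀ {x y z w} → z < x → w < x → z < y → w < y → ¬ H1Pattern x y z w
¬H1Pattern-skew₂ z<x w<x z<y w<y (p1324 x<z _ _) = <-asym x<z z<x
¬H1Pattern-skew₂ z<x w<x z<y w<y (p2314 _ _ y<w) = <-asym y<w w<y
¬H1Pattern-skew₂ z<x w<x z<y w<y (p2413 _ x<w _) = <-asym x<w w<x
¬H1Pattern-skew₂ z<x w<x z<y w<y (p3124 y<z _ _) = <-asym y<z z<y
¬H1Pattern-skew₂ z<x w<x z<y w<y (p3142 y<w _ _) = <-asym y<w w<y
¬H1Pattern-skew₂ z<x w<x z<y w<y (p3214 _ _ x<w) = <-asym x<w w<x

¬H1Pattern-skew₃ : ∀ {x y z w} → w < x → w < y → w < z → ¬ H1Pattern x y z w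
¬H1Pattern-skew₃ w<x w<y w<z (p1324 _ _ y<w) = <-asym y<w w<y
¬H1Pattern-skew₃ w<x w<y w<z (p2314 _ _ y<w) = <-asym y<w w<y
¬H1Pattern-skew₃ w<x w<y w<z (p2413 _ x<w _) = <-asym x<w w<x
¬H1Pattern-skew₃ w<x w<y w<z (p3124 _ _ x<w) = <-asym x<w w<x
¬H1Pattern-skew₃ w<x w<y w<z (p3142 y<w _ _) = <-asym y<w w<y
¬H1Pattern-skew₃ w<x w<y w<z (p3214 _ _ x<w) = <-asym x<w w<x

-- Every pattern of H₁ is skew-indecomposable.
skewSum-avoidsH1 : ∀ {m} xs {ys} → All (m ≤_) xs → All (_< m) ys → AvoidsH1 xs → AvoidsH1 ys →
                   AvoidsH1 (xs ++ ys)
skewSum-avoidsH1 xs {ys} high low avx avy o with split-⊆-++ xs ys o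
... | [] , _ , refl , _ , o₂ = avy o₂
... | _ ∷ [] , _ , refl , o₁ , o₂ with All-resp-⊆ o₁ high | All-resp-⊆ o₂ low
...   | m≤x ∷ [] | y<m ∷ z<m ∷ w<m ∷ [] =
  ¬H1Pattern-skew₁ (<-≤-trans y<m m≤x) (<-≤-trans z<m m≤x) (<-≤-trans w<m m≤x)
skewSum-avoidsH1 xs {ys} high low avx avy o | _ ∷ _ ∷ [] , _ , refl , o₁ , o₂
  with All-resp-⊆ o₁ high | All-resp-⊆ o₂ low
...   | m≤x ∷ m≤y ∷ [] | z<m ∷ w<m ∷ [] =
  ¬H1Pattern-skew₂ (<-≤-trans z<m m≤x) (<-≤-trans w<m m≤x) (<-≤-trans z<m m≤y) (<-≤-trans w<m m≤y)
skewSum-avoidsH1 xs {ys} high low avx avy o | _ ∷ _ ∷ _ ∷ [] , _ , refl , o₁ , o₂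
  with All-resp-⊆ o₁ high | All-resp-⊆ o₂ low
...   | m≤x ∷ m≤y ∷ m≤z ∷ [] | w<m ∷ [] =
  ¬H1Pattern-skew₃ (<-≤-trans w<m m≤x) (<-≤-trans w<m m≤y) (<-≤-trans w<m m≤z)
skewSum-avoidsH1 xs {ys} high low avx avy o | _ ∷ _ ∷ _ ∷ _ ∷ [] , [] , refl , o₁ , _ = avx o₁

H1Pattern-min⇒213 : ∀ {x y z w} → x < y → x < z → x < w → H1Pattern x y z w → z < y × y < w
H1Pattern-min⇒213 x<y x<z x<w (p1324 _ z<y y<w) = z<y , y<w
H1Pattern-min⇒213 x<y x<z x<w (p2314 z<x _ _) = contradiction x<z (<⇒≯ z<x)
H1Pattern-min⇒213 x<y x<z x<w (p2413 z<x _ _) = contradiction x<z (<⇒≯ z<x)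
H1Pattern-min⇒213 x<y x<z x<w (p3124 _ z<x _) = contradiction x<z (<⇒≯ z<x)
H1Pattern-min⇒213 x<y x<z x<w (p3142 _ w<x _) = contradiction x<w (<⇒≯ w<x)
H1Pattern-min⇒213 x<y x<z x<w (p3214 _ y<x _) = contradiction x<y (<⇒≯ y<x)

prependMin-avoidsH1 : ∀ {b xs} → All (b <_) xs → Avoids213 xs → AvoidsH1 (b ∷ xs)
prependMin-avoidsH1 above av (_ ∷ʳ o) = avoids213⇒avoidsH1 av o
prependMin-avoidsH1 above av (refl ∷ o) pat with All-resp-⊆ o above
... | b<y ∷ b<z ∷ b<w ∷ [] = let z<y , y<w = H1Pattern-min⇒213 b<y b<z b<w pat in av o z<y y<w

prepend21-avoidsH1 : ∀ {b xs} → All (suc b <_) xs → Avoids213 xs → AvoidsH1 (suc b ∷ b ∷ xs)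
prepend21-avoidsH1 above av (_ ∷ʳ o) = prependMin-avoidsH1 (All.map (<-trans (n<1+n _)) above) av o
prepend21-avoidsH1 above av (refl ∷ _ ∷ʳ o) pat with All-resp-⊆ o above
... | a<y ∷ a<z ∷ a<w ∷ [] = let z<y , y<w = H1Pattern-min⇒213 a<y a<z a<w pat in av o z<y y<w
prepend21-avoidsH1 above av (refl ∷ refl ∷ o) with All-resp-⊆ o above
... | a<z ∷ a<w ∷ [] = λ
  { (p1324 _ z<b _) → <-asym z<b (<-trans (n<1+n _) a<z)
  ; (p2314 z<a _ _) → <-asym z<a a<z
  ; (p2413 z<a _ _) → <-asym z<a a<z
  ; (p3124 b<z z<a _) → <-asym z<a a<z
  ; (p3142 _ w<a _) → <-asym w<a a<w
  ; (p3214 z<b _ _) → <-asym z<b (<-trans (n<1+n _) a<z) }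

node-avoids213 : ∀ {c xs ys} → All (c <_) xs → All (_< c) ys → Avoids213 xs → Avoids213 ys →
                 Avoids213 (c ∷ xs ++ ys)
node-avoids213 {xs = xs} {ys} above below avx avy (refl ∷ o) y<c c<z with split-⊆-++ xs ys o
... | [] , _ , refl , _ , o₂ with All-resp-⊆ o₂ below
...   | _ ∷ z<c ∷ [] = <-asym c<z z<c
node-avoids213 {xs = xs} {ys} above below avx avy (refl ∷ o) y<c c<z | _ ∷ [] , _ , refl , o₁ , _
  with All-resp-⊆ o₁ above
... | c<y ∷ _ = <-asym c<y y<c
node-avoids213 {xs = xs} {ys} above below avx avy (refl ∷ o) y<c c<z | _ ∷ _ ∷ [] , _ , refl , o₁ , _
  with All-resp-⊆ o₁ above
... | c<y ∷ _ = <-asym c<y y<c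
node-avoids213 {xs = xs} {ys} above below avx avy (_ ∷ʳ o) y<x x<z with split-⊆-++ xs ys o
... | [] , _ , refl , _ , o₂ = avy o₂ y<x x<z
... | _ ∷ [] , _ , refl , o₁ , o₂ with All-resp-⊆ o₁ above | All-resp-⊆ o₂ below
...   | c<x ∷ [] | _ ∷ z<c ∷ [] = <-asym x<z (<-trans z<c c<x)
node-avoids213 {xs = xs} {ys} above below avx avy (_ ∷ʳ o) y<x x<z | _ ∷ _ ∷ [] , _ , refl , o₁ , o₂
  with All-resp-⊆ o₁ above | All-resp-⊆ o₂ below
...   | _ ∷ c<y ∷ [] | z<c ∷ [] = <-asym (<-trans y<x x<z) (<-trans z<c c<y)
node-avoids213 {xs = xs} {ys} above below avx avy (_ ∷ʳ o) y<x x<z | _ ∷ _ ∷ _ ∷ [] , [] , refl , o₁ , _ =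
  avx o₁ y<x x<z

treePerm-avoids213 : ∀ lo t → Avoids213 (treePerm lo t)
treePerm-avoids213 lo leaf ()
treePerm-avoids213 lo (node l r) =
  node-avoids213 (All.map proj₁ (treePerm-inRange _ l)) (All.map proj₂ (treePerm-inRange lo r))
                 (treePerm-avoids213 _ l) (treePerm-avoids213 lo r)

blockPerm-avoidsH1 : ∀ b c → AvoidsH1 (blockPerm b c)
blockPerm-avoidsH1 b (plain t) =
  prependMin-avoidsH1 (All.map proj₁ (treePerm-inRange (suc b) t)) (treePerm-avoids213 (suc b) t)
blockPerm-avoidsH1 b (descent l r) =
  prepend21-avoidsH1 (All.map proj₁ (treePerm-inRange (suc (suc b)) (node l r))) (treePerm-avoids213 _ (node l r))

blocksPerm-avoidsH1 : ∀ lo bs → AvoidsH1 (blocksPerm lo bs)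
blocksPerm-avoidsH1 lo [] ()
blocksPerm-avoidsH1 lo (b ∷ bs) =
  skewSum-avoidsH1 (blockPerm _ b) (All.map proj₁ (blockPerm-inRange _ b)) (All.map proj₂ (blocksPerm-inRange lo bs))
                   (blockPerm-avoidsH1 _ b) (blocksPerm-avoidsH1 lo bs)

treePerm-unique : ∀ lo t → Unique (treePerm lo t)
treePerm-unique lo leaf = []
treePerm-unique lo (node l r) =
  ++⁺ (All.map (<⇒≢ ∘ proj₁) L-bounds) (All.map (>⇒≢ ∘ proj₂) R-bounds)
  ∷ Unique.++⁺ (treePerm-unique _ l) (treePerm-unique lo r)
               (separated⇒disjoint (All.map proj₁ L-bounds) (All.map (<-trans′ ∘ proj₂) R-bounds))
  where
  L-bounds = treePerm-inRange (suc (lo + size r)) l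
  R-bounds = treePerm-inRange lo r
  <-trans′ : ∀ {x} → x < lo + size r → x < suc (lo + size r)
  <-trans′ x<c = <-trans x<c (n<1+n _)

blockPerm-unique : ∀ b c → Unique (blockPerm b c)
blockPerm-unique b (plain t) =
  All.map (<⇒≢ ∘ proj₁) (treePerm-inRange (suc b) t) ∷ treePerm-unique (suc b) t
blockPerm-unique b (descent l r) =
  (>⇒≢ (n<1+n b) ∷ All.map (<⇒≢ ∘ proj₁) bounds)
  ∷ All.map (<⇒≢ ∘ <⇒≤ ∘ proj₁) bounds
  ∷ treePerm-unique _ (node l r)
  where bounds = treePerm-inRange (suc (suc b)) (node l r)

blocksPerm-unique : ∀ lo bs → Unique (blocksPerm lo bs)
blocksPerm-unique lo [] = []
blocksPerm-unique lo (b ∷ bs) =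
  Unique.++⁺ (blockPerm-unique _ b) (blocksPerm-unique lo bs)
             (separated⇒disjoint (All.map proj₁ (blockPerm-inRange _ b))
                                 (All.map proj₂ (blocksPerm-inRange lo bs)))

-- Decoding H₁-avoiding permutations

avoids213-below : ∀ {c xs ρ} → ρ ⊆ xs → Maybe.All (∁ (c <_)) (head ρ) → Unique (c ∷ xs) → Avoids213 (c ∷ xs) →
                  All (_< c) ρ
avoids213-below {ρ = []} _ _ _ _ = []
avoids213-below {c} {ρ = y ∷ ρ′} ρ⊆xs (just c≮y) (c≢xs ∷ _) av = y<c ∷ All.tabulate x<c
  where
  c≢ρ = All-resp-⊆ ρ⊆xs c≢xs
  y<c : y < c
  y<c = ≤∧≢⇒< (≮⇒≥ c≮y) (≢-sym (All.head c≢ρ))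
  x<c : ∀ {x} → x ∈ ρ′ → x < c
  x<c x∈ρ′ = ≤∧≢⇒< (≮⇒≥ λ c<x → av (refl ∷ ⊆-trans (refl ∷ from∈ x∈ρ′) ρ⊆xs) y<c c<x)
                   (≢-sym (All.lookup (All.tail c≢ρ) x∈ρ′))


treePerm-decodeTree : ∀ f lo hi xs → IsRangePerm lo hi xs → Avoids213 xs → length xs ≤ f →
                      treePerm lo (decodeTree f xs) ≡ xs
treePerm-decodeTree zero lo hi [] _ _ _ = refl
treePerm-decodeTree (suc f) lo hi [] _ _ _ = refl
treePerm-decodeTree (suc f) lo hi (c ∷ xs) rp av (s≤s le) = begin
  lo + size R ∷ treePerm (suc (lo + size R)) L ++ treePerm lo R
    ≡⟨ cong (λ d → d ∷ treePerm (suc d) L ++ treePerm lo R) root ⟩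
  c ∷ treePerm (suc c) L ++ treePerm lo R
    ≡⟨ cong (c ∷_) (cong₂ _++_ L-correct R-correct) ⟩
  c ∷ above ++ below
    ≡⟨ cong (c ∷_) (takeWhile++dropWhile P? xs) ⟩
  c ∷ xs ∎
  where
  open ≡-Reasoning
  open IsRangePerm rp
  P? = c <?_
  above = takeWhile P? xs
  below = dropWhile P? xs
  L = decodeTree f above
  R = decodeTree f below
  lo≤c = proj₁ (All.head bounded)
  below<c : All (_< c) below
  below<c = avoids213-below (dropWhile-⊆ P? xs) (all-head-dropWhile P? xs) unique av
  rp-above : IsRangePerm (suc c) hi above
  rp-above = proj₁ (rangePerm-splitAt rp below<c)
  rp-below : IsRangePerm lo c below
  rp-below = proj₂ (rangePerm-splitAt rp below<c)
  L-correct : treePerm (suc c) L ≡ above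
  L-correct = treePerm-decodeTree f (suc c) hi above rp-above (Avoids213-resp-⊆ (c ∷ʳ takeWhile-⊆ P? xs) av)
                (≤-trans (length-takeWhile≤ P? xs) le)
  R-correct : treePerm lo R ≡ below
  R-correct = treePerm-decodeTree f lo c below rp-below (Avoids213-resp-⊆ (c ∷ʳ dropWhile-⊆ P? xs) av)
                (≤-trans (length-dropWhile≤ P? xs) le)
  root : lo + size R ≡ c
  root = begin
    lo + size R                 ≡⟨ cong (lo +_) (sym (length-treePerm lo R)) ⟩
    lo + length (treePerm lo R) ≡⟨ cong (λ ys → lo + length ys) R-correct ⟩
    lo + length below           ≡⟨ length-rangePerm rp-below lo≤c ⟩
    c                           ∎

plain-rest-below : ∀ {a xs} τ ρ → xs ≡ τ ++ ρ → Unique (a ∷ xs) → AvoidsH1 (a ∷ xs) → ¬ DescentStart a xs →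
                   All (a <_) τ → Maybe.All (∁ (a <_)) (head ρ) → All (_< a) ρ
plain-rest-below τ [] _ _ _ _ _ _ = []
plain-rest-below {a} τ (v ∷ ρ′) refl (a≢ ∷ u) av ¬d above (just a≮v) = v<a ∷ All.tabulate x<a
  where
  v<a : v < a
  v<a = ≤∧≢⇒< (≮⇒≥ a≮v) (≢-sym (All.lookup a≢ (∈-++⁺ʳ τ (here refl))))
  a≮x : ∀ τ {x} → x ∈ ρ′ → Unique (a ∷ τ ++ v ∷ ρ′) → AvoidsH1 (a ∷ τ ++ v ∷ ρ′) →
        ¬ DescentStart a (τ ++ v ∷ ρ′) → All (a <_) τ → ¬ a < x
  a≮x [] (here refl) _ _ ¬d _ a<c = ¬d (descentStart v<a a<c)
  a≮x [] {x} (there {c} x∈) ((_ ∷ a≢c ∷ _) ∷ (v≢c ∷ _) ∷ _) av ¬d _ a<x with <-cmp v c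
  ... | tri< v<c _ _ = av (refl ∷ refl ∷ refl ∷ from∈ x∈) (p3124 v<c c<a a<x)
    where c<a = ≤∧≢⇒< (≮⇒≥ λ a<c → ¬d (descentStart v<a a<c)) (≢-sym a≢c)
  ... | tri≈ _ v≡c _ = v≢c v≡c
  ... | tri> _ _ c<v = av (refl ∷ refl ∷ refl ∷ from∈ x∈) (p3214 c<v v<a a<x)
  a≮x (w ∷ τ′) {x} x∈ (_ ∷ w≢ ∷ _) av _ (a<w ∷ _) a<x with <-cmp w x
  ... | tri< w<x _ _ = av (refl ∷ refl ∷ ++⁺ˡ τ′ (refl ∷ from∈ x∈)) (p2314 v<a a<w w<x)
  ... | tri≈ _ w≡x _ = All.lookup w≢ (∈-++⁺ʳ τ′ (there x∈)) w≡x
  ... | tri> _ _ x<w = av (refl ∷ refl ∷ ++⁺ˡ τ′ (refl ∷ from∈ x∈)) (p2413 v<a a<x x<w)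
  x<a : ∀ {x} → x ∈ ρ′ → x < a
  x<a x∈ = ≤∧≢⇒< (≮⇒≥ (a≮x τ x∈ (a≢ ∷ u) av ¬d above)) (≢-sym (All.lookup a≢ (∈-++⁺ʳ τ (there x∈))))

descent-rest-below : ∀ {a y c ys} τ ρ → ys ≡ τ ++ ρ → Unique (a ∷ y ∷ c ∷ ys) → AvoidsH1 (a ∷ y ∷ c ∷ ys) →
                     y < a → a < c → Maybe.All (∁ (a <_)) (head ρ) → All (_< y) ρ
descent-rest-below τ [] _ _ _ _ _ _ = []
descent-rest-below {a} {y} {c} τ (v ∷ ρ′) refl (a≢ ∷ y≢ ∷ _) av y<a a<c (just a≮v) = All.tabulate z<y
  where
  a≢ρ : All (a ≢_) (v ∷ ρ′)
  a≢ρ = ++⁻ʳ τ (All.tail (All.tail a≢))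
  y≢ρ : All (y ≢_) (v ∷ ρ′)
  y≢ρ = ++⁻ʳ τ (All.tail y≢)
  v<a : v < a
  v<a = ≤∧≢⇒< (≮⇒≥ a≮v) (≢-sym (All.head a≢ρ))
  a≮z : ∀ {z} → z ∈ v ∷ ρ′ → ¬ a < z
  a≮z (here refl) = a≮v
  a≮z (there z∈) a<z with <-cmp v y
  ... | tri< v<y _ _ = av (refl ∷ refl ∷ c ∷ʳ ++⁺ˡ τ (refl ∷ from∈ z∈)) (p3214 v<y y<a a<z)
  ... | tri≈ _ v≡y _ = All.head y≢ρ (sym v≡y)
  ... | tri> _ _ y<v = av (refl ∷ refl ∷ c ∷ʳ ++⁺ˡ τ (refl ∷ from∈ z∈)) (p3124 y<v v<a a<z)
  y≮z : ∀ {z} → z ∈ v ∷ ρ′ → ¬ y < z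
  y≮z {z} z∈ y<z with <-cmp z a
  ... | tri< z<a _ _ = av (refl ∷ refl ∷ refl ∷ ++⁺ˡ τ (from∈ z∈)) (p3142 y<z z<a a<c)
  ... | tri≈ _ z≡a _ = All.lookup a≢ρ z∈ (sym z≡a)
  ... | tri> _ _ a<z = a≮z z∈ a<z
  z<y : ∀ {z} → z ∈ v ∷ ρ′ → z < y
  z<y z∈ = ≤∧≢⇒< (≮⇒≥ (y≮z z∈)) (≢-sym (All.lookup y≢ρ z∈))

avoids213-above : ∀ {a xs} → All (a <_) xs → AvoidsH1 (a ∷ xs) → Avoids213 xs
avoids213-above above av o y<x x<z with All-resp-⊆ o above
... | _ ∷ a<y ∷ _ ∷ [] = av (refl ∷ o) (p1324 a<y y<x x<z)

rangePerm-totalSize : ∀ {lo c xs} bs → blocksPerm lo bs ≡ xs → IsRangePerm lo c xs → lo ≤ c → lo + totalSize bs ≡ c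
rangePerm-totalSize {lo} {c} {xs} bs eq rp lo≤c = begin
  lo + totalSize bs               ≡⟨ cong (lo +_) (sym (length-blocksPerm lo bs)) ⟩
  lo + length (blocksPerm lo bs)  ≡⟨ cong (λ ys → lo + length ys) eq ⟩
  lo + length xs                  ≡⟨ length-rangePerm rp lo≤c ⟩
  c                               ∎
  where open ≡-Reasoning

BlocksRoundtrip : ℕ → Set
BlocksRoundtrip f = ∀ lo hi xs → IsRangePerm lo hi xs → AvoidsH1 xs → length xs ≤ f →
                    blocksPerm lo (decodeBlocksPerm f xs) ≡ xs

plain-roundtrip : ∀ {f lo hi a xs} → BlocksRoundtrip f → IsRangePerm lo hi (a ∷ xs) → AvoidsH1 (a ∷ xs) →
  length xs ≤ f → ¬ DescentStart a xs →
  blocksPerm lo (plain (decodeTree f (takeWhile (a <?_) xs)) ∷ decodeBlocksPerm f (dropWhile (a <?_) xs)) ≡ a ∷ xs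
plain-roundtrip {f} {lo} {hi} {a} {xs} roundtrip rp av le ¬d = begin
  lo + totalSize bs ∷ treePerm (suc (lo + totalSize bs)) T ++ blocksPerm lo bs
    ≡⟨ cong (λ b → b ∷ treePerm (suc b) T ++ blocksPerm lo bs) (rangePerm-totalSize bs bs-correct rp-below lo≤a) ⟩
  a ∷ treePerm (suc a) T ++ blocksPerm lo bs
    ≡⟨ cong (a ∷_) (cong₂ _++_ T-correct bs-correct) ⟩
  a ∷ above ++ below
    ≡⟨ cong (a ∷_) (takeWhile++dropWhile P? xs) ⟩
  a ∷ xs ∎
  where
  open ≡-Reasoning
  open IsRangePerm rp
  P? = a <?_
  above = takeWhile P? xs
  below = dropWhile P? xs
  T = decodeTree f above
  bs = decodeBlocksPerm f below
  lo≤a = proj₁ (All.head bounded)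
  below<a : All (_< a) below
  below<a = plain-rest-below above below (sym (takeWhile++dropWhile P? xs)) unique av ¬d
              (all-takeWhile P? xs) (all-head-dropWhile P? xs)
  rp-above : IsRangePerm (suc a) hi above
  rp-above = proj₁ (rangePerm-splitAt rp below<a)
  rp-below : IsRangePerm lo a below
  rp-below = proj₂ (rangePerm-splitAt rp below<a)
  T-correct : treePerm (suc a) T ≡ above
  T-correct = treePerm-decodeTree f (suc a) hi above rp-above
    (avoids213-above (all-takeWhile P? xs) (AvoidsH1-resp-⊆ (refl ∷ takeWhile-⊆ P? xs) av))
    (≤-trans (length-takeWhile≤ P? xs) le)
  bs-correct : blocksPerm lo bs ≡ below
  bs-correct = roundtrip lo a below rp-below (AvoidsH1-resp-⊆ (a ∷ʳ dropWhile-⊆ P? xs) av)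
    (≤-trans (length-dropWhile≤ P? xs) le)

rangePerm-descent : ∀ {lo hi a y c} τ ρ → IsRangePerm lo hi (a ∷ y ∷ c ∷ τ ++ ρ) →
                    y < a → All (a <_) (c ∷ τ) → All (_< y) ρ →
                    IsRangePerm lo y ρ × IsRangePerm (suc a) hi (c ∷ τ) × suc y ≡ a
rangePerm-descent {lo} {hi} {a} {y} {c} τ ρ rp y<a τ>a ρ<y = rp-ρ , rp-τ , 1+y≡a
  where
  open IsRangePerm rp
  lo≤a = proj₁ (All.head bounded)
  a<hi = proj₂ (All.head bounded)
  lo≤y = proj₁ (All.head (All.tail bounded))
  τ-bounds : All (InRange lo hi) τ
  τ-bounds = proj₁ (++⁻ τ (All.tail (All.tail (All.tail bounded))))
  ρ-bounds : All (InRange lo hi) ρ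
  ρ-bounds = proj₂ (++⁻ τ (All.tail (All.tail (All.tail bounded))))
  classify : ∀ {x} → x ∈ a ∷ y ∷ c ∷ τ ++ ρ → x ≡ a ⊎ x ≡ y ⊎ x ∈ c ∷ τ ⊎ x ∈ ρ
  classify (here x≡a) = inj₁ x≡a
  classify (there (here x≡y)) = inj₂ (inj₁ x≡y)
  classify (there (there (here x≡c))) = inj₂ (inj₂ (inj₁ (here x≡c)))
  classify (there (there (there x∈))) = inj₂ (inj₂ ([ inj₁ ∘ there , inj₂ ]′ (∈-++⁻ τ x∈)))
  rp-ρ : IsRangePerm lo y ρ
  rp-ρ = rangePerm-restrict rp ≤-refl (<⇒≤ (<-trans y<a a<hi)) (a ∷ʳ y ∷ʳ c ∷ʳ ++⁺ˡ τ ⊆-refl)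
    (All.zipWith (λ ((lo≤x , _) , x<y) → lo≤x , x<y) (ρ-bounds , ρ<y))
    λ x∈ (_ , x<y) → case classify x∈ of λ
      { (inj₁ refl) → contradiction y<a (<⇒≯ x<y)
      ; (inj₂ (inj₁ refl)) → contradiction x<y (<-irrefl refl)
      ; (inj₂ (inj₂ (inj₁ x∈τ))) → contradiction (<-trans y<a (All.lookup τ>a x∈τ)) (<⇒≯ x<y)
      ; (inj₂ (inj₂ (inj₂ x∈ρ))) → x∈ρ }
  rp-τ : IsRangePerm (suc a) hi (c ∷ τ)
  rp-τ = rangePerm-restrict rp (≤-trans lo≤a (n≤1+n a)) ≤-refl (a ∷ʳ y ∷ʳ refl ∷ ++⁺ʳ ρ ⊆-refl)
    (All.zipWith (λ (a<x , (_ , x<hi)) → a<x , x<hi) (τ>a , All.head (All.tail (All.tail bounded)) ∷ τ-bounds))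
    λ x∈ (a<x , _) → case classify x∈ of λ
      { (inj₁ refl) → contradiction a<x (<-irrefl refl)
      ; (inj₂ (inj₁ refl)) → contradiction y<a (<⇒≯ a<x)
      ; (inj₂ (inj₂ (inj₁ x∈τ))) → x∈τ
      ; (inj₂ (inj₂ (inj₂ x∈ρ))) → contradiction (<-trans (All.lookup ρ<y x∈ρ) y<a) (<⇒≯ a<x) }
  1+y≡a : suc y ≡ a
  1+y≡a = ≤-antisym y<a (≮⇒≥ λ 1+y<a →
    case classify (complete (≤-trans lo≤y (n≤1+n y)) (<-trans 1+y<a a<hi)) of λ
      { (inj₁ refl) → <-irrefl refl 1+y<a
      ; (inj₂ (inj₁ 1+y≡y)) → <-irrefl (sym 1+y≡y) (n<1+n y)
      ; (inj₂ (inj₂ (inj₁ 1+y∈τ))) → <-asym 1+y<a (All.lookup τ>a 1+y∈τ)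
      ; (inj₂ (inj₂ (inj₂ 1+y∈ρ))) → <-asym (n<1+n y) (All.lookup ρ<y 1+y∈ρ) })

descent-roundtrip : ∀ {f lo hi a y c ys} → BlocksRoundtrip f → IsRangePerm lo hi (a ∷ y ∷ c ∷ ys) →
  AvoidsH1 (a ∷ y ∷ c ∷ ys) → length ys ≤ f → y < a → a < c →
  let τ = takeWhile (a <?_) ys in
  blocksPerm lo (descent (decodeTree f (takeWhile (c <?_) τ)) (decodeTree f (dropWhile (c <?_) τ))
                 ∷ decodeBlocksPerm f (dropWhile (a <?_) ys)) ≡ a ∷ y ∷ c ∷ ys
descent-roundtrip {f} {lo} {hi} {a} {y} {c} {ys} roundtrip rp av le y<a a<c = begin
  suc b ∷ b ∷ treePerm (suc (suc b)) T ++ blocksPerm lo bs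
    ≡⟨ cong (λ d → suc d ∷ d ∷ treePerm (suc (suc d)) T ++ blocksPerm lo bs)
            (rangePerm-totalSize bs bs-correct rp-ρ lo≤y) ⟩
  suc y ∷ y ∷ treePerm (suc (suc y)) T ++ blocksPerm lo bs
    ≡⟨ cong (λ d → d ∷ y ∷ treePerm (suc d) T ++ blocksPerm lo bs) 1+y≡a ⟩
  a ∷ y ∷ treePerm (suc a) T ++ blocksPerm lo bs
    ≡⟨ cong (λ zs → a ∷ y ∷ zs) (cong₂ _++_ T-correct bs-correct) ⟩
  a ∷ y ∷ c ∷ τ ++ ρ
    ≡⟨ cong (λ zs → a ∷ y ∷ c ∷ zs) ys≡τ++ρ ⟨
  a ∷ y ∷ c ∷ ys ∎
  where
  open ≡-Reasoning
  P? = a <?_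
  τ = takeWhile P? ys
  ρ = dropWhile P? ys
  ys≡τ++ρ = sym (takeWhile++dropWhile P? ys)
  T = decodeTree (suc f) (c ∷ τ)
  bs = decodeBlocksPerm f ρ
  b = lo + totalSize bs
  lo≤y = proj₁ (All.head (All.tail (IsRangePerm.bounded rp)))
  τ>a : All (a <_) (c ∷ τ)
  τ>a = a<c ∷ all-takeWhile P? ys
  ρ<y : All (_< y) ρ
  ρ<y = descent-rest-below τ ρ ys≡τ++ρ (IsRangePerm.unique rp) av y<a a<c (all-head-dropWhile P? ys)
  ranges = rangePerm-descent τ ρ (subst (λ zs → IsRangePerm lo hi (a ∷ y ∷ c ∷ zs)) ys≡τ++ρ rp) y<a τ>a ρ<y
  rp-ρ = proj₁ ranges
  rp-τ = proj₁ (proj₂ ranges)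
  1+y≡a = proj₂ (proj₂ ranges)
  T-correct : treePerm (suc a) T ≡ c ∷ τ
  T-correct = treePerm-decodeTree (suc f) (suc a) hi (c ∷ τ) rp-τ
    (avoids213-above τ>a (AvoidsH1-resp-⊆ (refl ∷ y ∷ʳ refl ∷ takeWhile-⊆ P? ys) av))
    (s≤s (≤-trans (length-takeWhile≤ P? ys) le))
  bs-correct : blocksPerm lo bs ≡ ρ
  bs-correct = roundtrip lo y ρ rp-ρ (AvoidsH1-resp-⊆ (a ∷ʳ y ∷ʳ c ∷ʳ dropWhile-⊆ P? ys) av)
    (≤-trans (length-dropWhile≤ P? ys) le)

blocksPerm-decodeBlocksPerm : ∀ f → BlocksRoundtrip f
blocksPerm-decodeBlocksPerm zero lo hi [] _ _ _ = refl
blocksPerm-decodeBlocksPerm (suc f) lo hi [] _ _ _ = refl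
blocksPerm-decodeBlocksPerm (suc f) lo hi (a ∷ xs) rp av (s≤s le) with descentStart? a xs
... | no ¬d = plain-roundtrip (blocksPerm-decodeBlocksPerm f) rp av le ¬d
... | yes (descentStart y<a a<c) =
  descent-roundtrip (blocksPerm-decodeBlocksPerm f) rp av (≤-trans (n≤1+n _) (≤-trans (n≤1+n _) le)) y<a a<c

values : ∀ {m k} → Vec (Fin m) k → List ℕ
values v = List.map toℕ (toList v)

values-cast : ∀ {m k k′} .(eq : k ≡ k′) (v : Vec (Fin m) k) → values (cast eq v) ≡ values v
values-cast eq v = cong (List.map toℕ) (toList-cast eq v)

values-injective : ∀ {m k} {u v : Vec (Fin m) k} → values u ≡ values v → u ≡ v
values-injective {u = u} {v} eq =
  trans (sym (cast-is-id refl u)) (toList-injective refl u v (map-injective toℕ-injective eq))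

fromValues : ∀ {m} xs → All (_< m) xs → Vec (Fin m) (length xs)
fromValues [] [] = []
fromValues (x ∷ xs) (x<m ∷ xs<m) = Fin.fromℕ< x<m ∷ fromValues xs xs<m

values-fromValues : ∀ {m} xs (xs<m : All (_< m) xs) → values (fromValues xs xs<m) ≡ xs
values-fromValues [] [] = refl
values-fromValues (x ∷ xs) (x<m ∷ xs<m) = cong₂ _∷_ (toℕ-fromℕ< x<m) (values-fromValues xs xs<m)

length-values : ∀ {m k} (v : Vec (Fin m) k) → length (values v) ≡ k
length-values [] = refl
length-values (x ∷ v) = cong suc (length-values v)

values-bounded : ∀ {m k} (v : Vec (Fin m) k) → All (_< m) (values v)
values-bounded [] = []
values-bounded (x ∷ v) = toℕ<n x ∷ values-bounded v

∈-values⁺ : ∀ {m k} (v : Vec (Fin m) k) i → toℕ (lookup v i) ∈ values v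
∈-values⁺ (x ∷ v) zero = here refl
∈-values⁺ (x ∷ v) (suc i) = there (∈-values⁺ v i)

∈-values⁻ : ∀ {m k} (v : Vec (Fin m) k) {z} → z ∈ values v → ∃ λ i → toℕ (lookup v i) ≡ z
∈-values⁻ (x ∷ v) (here refl) = zero , refl
∈-values⁻ (x ∷ v) (there z∈) = let i , eq = ∈-values⁻ v z∈ in suc i , eq

values-unique⁺ : ∀ {m k} (v : Vec (Fin m) k) → (∀ i j → lookup v i ≡ lookup v j → i ≡ j) → Unique (values v)
values-unique⁺ [] _ = []
values-unique⁺ (x ∷ v) inj =
  All.tabulate (λ x∈v x≡ → let i , eq = ∈-values⁻ v x∈v in
                 Finₚ.0≢1+n (inj zero (suc i) (toℕ-injective (trans x≡ (sym eq)))))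
  ∷ values-unique⁺ v (λ i j eq → Finₚ.suc-injective (inj (suc i) (suc j) eq))

values-unique⁻ : ∀ {m k} (v : Vec (Fin m) k) → Unique (values v) → ∀ i j → lookup v i ≡ lookup v j → i ≡ j
values-unique⁻ (x ∷ v) _ zero zero _ = refl
values-unique⁻ (x ∷ v) (x∉ ∷ _) zero (suc j) x≡ = contradiction (cong toℕ x≡) (All.lookup x∉ (∈-values⁺ v j))
values-unique⁻ (x ∷ v) (x∉ ∷ _) (suc i) zero ≡x = contradiction (cong toℕ (sym ≡x)) (All.lookup x∉ (∈-values⁺ v i))
values-unique⁻ (x ∷ v) (_ ∷ u) (suc i) (suc j) eq = cong suc (values-unique⁻ v u i j eq)

values-rangePerm : ∀ {m} (π : Vec (Fin m) m) → IsPerm π → IsRangePerm 0 m (values π)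
values-rangePerm {m} π perm = record
  { unique   = u
  ; bounded  = All.map (z≤n ,_) (values-bounded π)
  ; complete = λ _ x<m → unique-⊆-complete u (∈-upTo⁺ ∘ All.lookup (values-bounded π))
                          (≤-reflexive (trans (length-upTo m) (sym (length-values π)))) (∈-upTo⁺ x<m)
  }
  where u = values-unique⁺ π perm

Increasing : ∀ {n k} → (Fin n → Fin k) → Set
Increasing g = ∀ a b → a Fin.< b → g a Fin.< g b

⊆-values⇒increasing : ∀ {m k xs} (v : Vec (Fin m) k) → xs ⊆ values v →
  Σ (Fin (length xs) → Fin k) λ g → Increasing g × (∀ a → toℕ (lookup v (g a)) ≡ List.lookup xs a)
⊆-values⇒increasing [] [] = (λ ()) , (λ ()) , (λ ())
⊆-values⇒increasing (x ∷ v) (_ ∷ʳ o) =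
  let g , inc , val = ⊆-values⇒increasing v o in suc ∘ g , (λ a b a<b → s≤s (inc a b a<b)) , val
⊆-values⇒increasing {k = suc k} {xs = _ ∷ xs} (x ∷ v) (refl ∷ o) = g′ , inc′ , val′
  where
  g,inc,val = ⊆-values⇒increasing v o
  g = proj₁ g,inc,val
  g′ : Fin (suc (length xs)) → Fin (suc k)
  g′ zero = zero
  g′ (suc a) = suc (g a)
  inc′ : Increasing g′
  inc′ zero (suc b) _ = s≤s z≤n
  inc′ (suc a) (suc b) (s≤s a<b) = s≤s (proj₁ (proj₂ g,inc,val) a b a<b)
  val′ : ∀ a → toℕ (lookup (x ∷ v) (g′ a)) ≡ List.lookup (toℕ x ∷ xs) a
  val′ zero = refl
  val′ (suc a) = proj₂ (proj₂ g,inc,val) a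

shiftDown : ∀ {n k} (g : Fin n → Fin (suc k)) → Increasing g → (∀ a → 0 < toℕ (g a)) →
            Σ (Fin n → Fin k) λ g′ → Increasing g′ × (∀ a → g a ≡ suc (g′ a))
shiftDown g inc pos = g′ , (λ a b a<b → ≤-pred (subst₂ Fin._<_ (g≡ a) (g≡ b) (inc a b a<b))) , g≡
  where
  predOf : ∀ {k} (i : Fin (suc k)) → 0 < toℕ i → ∃ λ j → i ≡ suc j
  predOf (suc j) _ = j , refl
  g′ = λ a → proj₁ (predOf (g a) (pos a))
  g≡ = λ a → proj₂ (predOf (g a) (pos a))

mutual
  increasing⇒⊆-values : ∀ {m k n} (v : Vec (Fin m) k) (g : Fin n → Fin k) → Increasing g →
                        List.tabulate (λ a → toℕ (lookup v (g a))) ⊆ values v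
  increasing⇒⊆-values {n = zero} v g inc = minimum _
  increasing⇒⊆-values {n = suc n} [] g inc with g zero
  ... | ()
  increasing⇒⊆-values {n = suc n} (x ∷ v) g inc with g zero Fin.≟ zero
  ... | yes g0≡0 = cong (toℕ ∘ lookup (x ∷ v)) g0≡0 ∷ tabulate-suc-⊆ x v (g ∘ suc)
          (λ a b a<b → inc (suc a) (suc b) (s≤s a<b))
          (λ a → subst (λ i → toℕ i < toℕ (g (suc a))) g0≡0 (inc zero (suc a) (s≤s z≤n)))
  ... | no g0≢0 = _ ∷ʳ tabulate-suc-⊆ x v g inc pos
    where
    pos : ∀ a → 0 < toℕ (g a)
    pos zero = n≢0⇒n>0 (g0≢0 ∘ toℕ-injective)
    pos (suc a) = <-trans (pos zero) (inc zero (suc a) (s≤s z≤n))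

  tabulate-suc-⊆ : ∀ {m k n} x (v : Vec (Fin m) k) (g : Fin n → Fin (suc k)) → Increasing g →
                   (∀ a → 0 < toℕ (g a)) → List.tabulate (λ a → toℕ (lookup (x ∷ v) (g a))) ⊆ values v
  tabulate-suc-⊆ x v g inc pos =
    let g′ , inc′ , g≡ = shiftDown g inc pos in
    subst (_⊆ values v) (sym (tabulate-cong (cong (toℕ ∘ lookup (x ∷ v)) ∘ g≡))) (increasing⇒⊆-values v g′ inc′)

module _ (u : Fin 4 → ℕ) (u₀<u₁ : u (# 0) < u (# 1)) (u₁<u₂ : u (# 1) < u (# 2)) (u₂<u₃ : u (# 2) < u (# 3)) where

  chain-increasing : ∀ i j → i Fin.< j → u i < u j
  chain-increasing zero (suc zero) _ = u₀<u₁
  chain-increasing zero (suc (suc zero)) _ = <-trans u₀<u₁ u₁<u₂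
  chain-increasing zero (suc (suc (suc zero))) _ = <-trans (<-trans u₀<u₁ u₁<u₂) u₂<u₃
  chain-increasing (suc zero) (suc (suc zero)) _ = u₁<u₂
  chain-increasing (suc zero) (suc (suc (suc zero))) _ = <-trans u₁<u₂ u₂<u₃
  chain-increasing (suc (suc zero)) (suc (suc (suc zero))) _ = u₂<u₃
  chain-increasing _ zero ()
  chain-increasing (suc zero) (suc zero) (s≤s ())
  chain-increasing (suc (suc zero)) (suc zero) (s≤s ())
  chain-increasing (suc (suc zero)) (suc (suc zero)) (s≤s (s≤s ()))
  chain-increasing (suc (suc (suc zero))) (suc zero) (s≤s ())
  chain-increasing (suc (suc (suc zero))) (suc (suc zero)) (s≤s (s≤s ()))
  chain-increasing (suc (suc (suc zero))) (suc (suc (suc zero))) (s≤s (s≤s (s≤s ())))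

  chain-<⇔< : ∀ i j → (u i < u j) ⇔ (i Fin.< j)
  chain-<⇔< i j = mk⇔ to (chain-increasing i j)
    where
    to : u i < u j → i Fin.< j
    to ui<uj with Finₚ.<-cmp i j
    ... | tri< i<j _ _ = i<j
    ... | tri≈ _ refl _ = contradiction ui<uj (<-irrefl refl)
    ... | tri> _ _ j<i = contradiction (chain-increasing j i j<i) (<⇒≯ ui<uj)

orderIso : ∀ (V : Fin 4 → ℕ) (τ σ : Vec (Fin 4) 4) → (∀ a → lookup σ (lookup τ a) ≡ a) →
           V (lookup σ (# 0)) < V (lookup σ (# 1)) → V (lookup σ (# 1)) < V (lookup σ (# 2)) →
           V (lookup σ (# 2)) < V (lookup σ (# 3)) →
           ∀ a b → (V a < V b) ⇔ (lookup τ a Fin.< lookup τ b)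
orderIso V τ σ στ≡id v₀<v₁ v₁<v₂ v₂<v₃ a b =
  subst₂ (λ p q → (V p < V q) ⇔ _) (στ≡id a) (στ≡id b)
         (chain-<⇔< (V ∘ lookup σ) v₀<v₁ v₁<v₂ v₂<v₃ (lookup τ a) (lookup τ b))

module _ {m} (π : Vec (Fin m) m) where

  avoidsH1⇒Avoids : AvoidsH1 (values π) → Avoids π H1
  avoidsH1⇒Avoids av =
      ¬contains (# 0 ∷ # 2 ∷ # 1 ∷ # 3 ∷ []) (λ lt → p1324 (lt (# 0) (# 2)) (lt (# 2) (# 1)) (lt (# 1) (# 3)))
    ∷ ¬contains (# 1 ∷ # 2 ∷ # 0 ∷ # 3 ∷ []) (λ lt → p2314 (lt (# 2) (# 0)) (lt (# 0) (# 1)) (lt (# 1) (# 3)))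
    ∷ ¬contains (# 1 ∷ # 3 ∷ # 0 ∷ # 2 ∷ []) (λ lt → p2413 (lt (# 2) (# 0)) (lt (# 0) (# 3)) (lt (# 3) (# 1)))
    ∷ ¬contains (# 2 ∷ # 0 ∷ # 1 ∷ # 3 ∷ []) (λ lt → p3124 (lt (# 1) (# 2)) (lt (# 2) (# 0)) (lt (# 0) (# 3)))
    ∷ ¬contains (# 2 ∷ # 0 ∷ # 3 ∷ # 1 ∷ []) (λ lt → p3142 (lt (# 1) (# 3)) (lt (# 3) (# 0)) (lt (# 0) (# 2)))
    ∷ ¬contains (# 2 ∷ # 1 ∷ # 0 ∷ # 3 ∷ []) (λ lt → p3214 (lt (# 2) (# 1)) (lt (# 1) (# 0)) (lt (# 0) (# 3)))
    ∷ []
    where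
    ¬contains : ∀ τ → (∀ {V : Fin 4 → ℕ} → (∀ a b → {True (lookup τ a Fin.<? lookup τ b)} → V a < V b) →
                         H1Pattern (V (# 0)) (V (# 1)) (V (# 2)) (V (# 3))) →
                ¬ Contains π τ
    ¬contains τ pat (g , inc , iso) =
      av (increasing⇒⊆-values π g inc)
         (pat {V = λ a → toℕ (lookup π (g a))} (λ a b {t} → Equivalence.from (iso a b) (toWitness t)))

  Avoids⇒avoidsH1 : Avoids π H1 → AvoidsH1 (values π)
  Avoids⇒avoidsH1 (¬c₁ ∷ ¬c₂ ∷ ¬c₃ ∷ ¬c₄ ∷ ¬c₅ ∷ ¬c₆ ∷ []) {x} {y} {z} {w} o = λ
    { (p1324 x<z z<y y<w) → ¬c₁ (contains (# 0 ∷ # 2 ∷ # 1 ∷ # 3 ∷ []) (# 0 ∷ # 2 ∷ # 1 ∷ # 3 ∷ [])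
        (lift (# 0) (# 2) x<z) (lift (# 2) (# 1) z<y) (lift (# 1) (# 3) y<w))
    ; (p2314 z<x x<y y<w) → ¬c₂ (contains (# 1 ∷ # 2 ∷ # 0 ∷ # 3 ∷ []) (# 2 ∷ # 0 ∷ # 1 ∷ # 3 ∷ [])
        (lift (# 2) (# 0) z<x) (lift (# 0) (# 1) x<y) (lift (# 1) (# 3) y<w))
    ; (p2413 z<x x<w w<y) → ¬c₃ (contains (# 1 ∷ # 3 ∷ # 0 ∷ # 2 ∷ []) (# 2 ∷ # 0 ∷ # 3 ∷ # 1 ∷ [])
        (lift (# 2) (# 0) z<x) (lift (# 0) (# 3) x<w) (lift (# 3) (# 1) w<y))
    ; (p3124 y<z z<x x<w) → ¬c₄ (contains (# 2 ∷ # 0 ∷ # 1 ∷ # 3 ∷ []) (# 1 ∷ # 2 ∷ # 0 ∷ # 3 ∷ [])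
        (lift (# 1) (# 2) y<z) (lift (# 2) (# 0) z<x) (lift (# 0) (# 3) x<w))
    ; (p3142 y<w w<x x<z) → ¬c₅ (contains (# 2 ∷ # 0 ∷ # 3 ∷ # 1 ∷ []) (# 1 ∷ # 3 ∷ # 0 ∷ # 2 ∷ [])
        (lift (# 1) (# 3) y<w) (lift (# 3) (# 0) w<x) (lift (# 0) (# 2) x<z))
    ; (p3214 z<y y<x x<w) → ¬c₆ (contains (# 2 ∷ # 1 ∷ # 0 ∷ # 3 ∷ []) (# 2 ∷ # 1 ∷ # 0 ∷ # 3 ∷ [])
        (lift (# 2) (# 1) z<y) (lift (# 1) (# 0) y<x) (lift (# 0) (# 3) x<w))
    }
    where
    increasing = ⊆-values⇒increasing π o
    g = proj₁ increasing
    V : Fin 4 → ℕ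
    V a = toℕ (lookup π (g a))
    lift : ∀ a b → List.lookup (x ∷ y ∷ z ∷ w ∷ []) a < List.lookup (x ∷ y ∷ z ∷ w ∷ []) b → V a < V b
    lift a b = subst₂ _<_ (sym (proj₂ (proj₂ increasing) a)) (sym (proj₂ (proj₂ increasing) b))
    contains : ∀ τ σ → {True (Finₚ.all? λ a → lookup σ (lookup τ a) Fin.≟ a)} →
               V (lookup σ (# 0)) < V (lookup σ (# 1)) → V (lookup σ (# 1)) < V (lookup σ (# 2)) →
               V (lookup σ (# 2)) < V (lookup σ (# 3)) → Contains π τ
    contains τ σ {inv} v₀<v₁ v₁<v₂ v₂<v₃ =
      g , proj₁ (proj₂ increasing) , orderIso V τ σ (toWitness inv) v₀<v₁ v₁<v₂ v₂<v₃

StepCondition : ∀ n → Vec ℕ n → Set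
StepCondition n w = (i : ℕ) (p : suc i < n) → lookup w (Fin.fromℕ< p) ≤ lookup w (Fin.fromℕ< (pred< p)) + 1

ZeroCondition : ∀ n → Vec ℕ n → Set
ZeroCondition n w = (i : ℕ) (p : suc i < n) → lookup w (Fin.fromℕ< p) ≡ 0 →
  Σ (suc (suc (suc i)) < n) λ q → (lookup w (Fin.fromℕ< (pred< q)) ≡ 1) × (lookup w (Fin.fromℕ< q) ≡ 2)

steps⁺ : ∀ {k} x (w : Vec ℕ k) → StepCondition (suc k) (x ∷ w) → Steps x (toList w)
steps⁺ x [] _ = []
steps⁺ x (y ∷ w) step =
  subst (y ≤_) (+-comm x 1) (step 0 (s≤s (s≤s z≤n))) ∷ steps⁺ y w (λ i p → step (suc i) (s≤s p))

steps⁻ : ∀ {k} x (w : Vec ℕ k) → Steps x (toList w) → StepCondition (suc k) (x ∷ w)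
steps⁻ x [] _ _ (s≤s ())
steps⁻ x (y ∷ w) (y≤ ∷ _) zero _ = subst (y ≤_) (+-comm 1 x) y≤
steps⁻ x (y ∷ w) (_ ∷ s) (suc i) (s≤s p) = steps⁻ y w s i p

opens12⁺ : ∀ {k} x y (w : Vec ℕ k) (q : 3 < suc (suc k)) → lookup (x ∷ y ∷ w) (Fin.fromℕ< (pred< q)) ≡ 1 →
           lookup (x ∷ y ∷ w) (Fin.fromℕ< q) ≡ 2 → Opens12 (toList w)
opens12⁺ x y (a ∷ b ∷ w) _ refl refl = toList w , refl
opens12⁺ x y [] (s≤s (s≤s ())) _ _
opens12⁺ x y (_ ∷ []) (s≤s (s≤s (s≤s ()))) _ _

opens12⁻ : ∀ {k} x y (w : Vec ℕ k) → Opens12 (toList w) →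
           Σ (3 < suc (suc k)) λ q →
             (lookup (x ∷ y ∷ w) (Fin.fromℕ< (pred< q)) ≡ 1) × (lookup (x ∷ y ∷ w) (Fin.fromℕ< q) ≡ 2)
opens12⁻ x y (.1 ∷ .2 ∷ w) (_ , refl) = s≤s (s≤s (s≤s (s≤s z≤n))) , refl , refl

zeroRule⁺ : ∀ {k} x (w : Vec ℕ k) → ZeroCondition (suc k) (x ∷ w) → ZeroRule (toList w)
zeroRule⁺ x [] _ = []
zeroRule⁺ x (y ∷ w) zeros =
  (λ y≡0 → let q , q₁ , q₂ = zeros 0 (s≤s (s≤s z≤n)) y≡0 in opens12⁺ x y w q q₁ q₂)
  ∷ zeroRule⁺ y w (λ i p y≡0 → let q , q₁ , q₂ = zeros (suc i) (s≤s p) y≡0 in ≤-pred q , q₁ , q₂)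

zeroRule⁻ : ∀ {k} x (w : Vec ℕ k) → ZeroRule (toList w) → ZeroCondition (suc k) (x ∷ w)
zeroRule⁻ x [] _ _ (s≤s ())
zeroRule⁻ x (y ∷ w) (opens ∷ _) zero _ y≡0 = opens12⁻ x y w (opens y≡0)
zeroRule⁻ x (y ∷ w) (_ ∷ z) (suc i) (s≤s p) y≡0 = let q , q₁ , q₂ = zeroRule⁻ y w z i p y≡0 in s≤s q , q₁ , q₂

IsF13⇒valid : ∀ {k} x (w : Vec ℕ k) → IsF13 (suc k) (x ∷ w) → x ≡ 0 × Steps 0 (toList w) × ZeroRule (toList w)
IsF13⇒valid x w isF13 = x≡0 , subst (λ p → Steps p (toList w)) x≡0 (steps⁺ x w step) , zeroRule⁺ x w zeros
  where
  open IsF13 isF13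
  x≡0 = first (s≤s z≤n)

valid⇒IsF13 : ∀ {k} (w : Vec ℕ k) → Steps 0 (toList w) → ZeroRule (toList w) → IsF13 (suc k) (0 ∷ w)
valid⇒IsF13 w s z = record { first = λ _ → refl ; step = steps⁻ 0 w s ; zeros = zeroRule⁻ 0 w z }

-- The bijection

Blocks : ℕ → Set
Blocks m = Σ (List Block) λ bs → totalSize bs ≡ m

Blocks-≡ : ∀ {m} {b b′ : Blocks m} → proj₁ b ≡ proj₁ b′ → b ≡ b′
Blocks-≡ {b = bs , p} {.bs , q} refl = cong (bs ,_) (≡-irrelevant p q)

module Words (m : ℕ) where

  blocksWord-decode : ∀ x (w : Vec ℕ m) → IsF13 (suc m) (x ∷ w) →
                      blocksWord (decodeBlocks m (toList w)) ≡ toList w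
  blocksWord-decode x w isF13 =
    let _ , s , z = IsF13⇒valid x w isF13 in blocksWord-decodeBlocks m (toList w) s z (≤-reflexive (length-toList w))

  blocksOfWord : F13 (suc m) → Blocks m
  blocksOfWord (x ∷ w , isF13) = decodeBlocks m (toList w) , (begin
    totalSize (decodeBlocks m (toList w))            ≡⟨ length-blocksWord (decodeBlocks m (toList w)) ⟨
    length (blocksWord (decodeBlocks m (toList w)))  ≡⟨ cong length (blocksWord-decode x w isF13) ⟩
    length (toList w)                                ≡⟨ length-toList w ⟩
    m                                                ∎)
    where open ≡-Reasoning

  wordTail : Blocks m → Vec ℕ m
  wordTail (bs , size) = cast (trans (length-blocksWord bs) size) (fromList (blocksWord bs))

  toList-wordTail : ∀ b → toList (wordTail b) ≡ blocksWord (proj₁ b)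
  toList-wordTail (bs , size) = trans (toList-cast _ (fromList (blocksWord bs))) (toList∘fromList (blocksWord bs))

  wordOfBlocks : Blocks m → F13 (suc m)
  wordOfBlocks b@(bs , _) = 0 ∷ wordTail b ,
    valid⇒IsF13 (wordTail b) (subst (Steps 0) (sym (toList-wordTail b)) (steps-blocksWord bs (s≤s z≤n)))
                         (subst ZeroRule (sym (toList-wordTail b)) (zeroRule-blocksWord bs))

  wordOfBlocks∘blocksOfWord : ∀ x → proj₁ (wordOfBlocks (blocksOfWord x)) ≡ proj₁ x
  wordOfBlocks∘blocksOfWord (x ∷ w , isF13) =
    cong₂ _∷_ (sym (proj₁ (IsF13⇒valid x w isF13)))
              (trans (sym (cast-is-id refl _)) (toList-injective refl _ w
                (trans (toList-wordTail (blocksOfWord (x ∷ w , isF13))) (blocksWord-decode x w isF13))))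

  blocksOfWord∘wordOfBlocks : ∀ b → blocksOfWord (wordOfBlocks b) ≡ b
  blocksOfWord∘wordOfBlocks b@(bs , size) = Blocks-≡ $
    trans (cong (decodeBlocks m) (toList-wordTail b)) (decodeBlocks-blocksWord m bs (≤-reflexive size))

module Perms (m : ℕ) where

  blocksPerm-decode : (π : Vec (Fin m) m) → IsPerm π → Avoids π H1 →
                      blocksPerm 0 (decodeBlocksPerm m (values π)) ≡ values π
  blocksPerm-decode π perm av = blocksPerm-decodeBlocksPerm m 0 m (values π) (values-rangePerm π perm)
                                  (Avoids⇒avoidsH1 π av) (≤-reflexive (length-values π))

  blocksOfPerm : SH1 m → Blocks m
  blocksOfPerm (π , perm , av) = decodeBlocksPerm m (values π) , (begin
    totalSize (decodeBlocksPerm m (values π))                ≡⟨ length-blocksPerm 0 (decodeBlocksPerm m (values π)) ⟨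
    length (blocksPerm 0 (decodeBlocksPerm m (values π)))    ≡⟨ cong length (blocksPerm-decode π perm av) ⟩
    length (values π)                                        ≡⟨ length-values π ⟩
    m                                                        ∎)
    where open ≡-Reasoning

  perm : Blocks m → Vec (Fin m) m
  perm (bs , size) = cast (trans (length-blocksPerm 0 bs) size)
    (fromValues (blocksPerm 0 bs) (All.map (λ (_ , x<) → subst (_ <_) size x<) (blocksPerm-inRange 0 bs)))

  values-perm : ∀ b → values (perm b) ≡ blocksPerm 0 (proj₁ b)
  values-perm (bs , size) = trans (values-cast _ _) (values-fromValues _ _)

  permOfBlocks : Blocks m → SH1 m
  permOfBlocks b@(bs , _) = perm b ,
    values-unique⁻ (perm b) (subst Unique (sym (values-perm b)) (blocksPerm-unique 0 bs)) ,
    avoidsH1⇒Avoids (perm b) (subst AvoidsH1 (sym (values-perm b)) (blocksPerm-avoidsH1 0 bs))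

  permOfBlocks∘blocksOfPerm : ∀ y → proj₁ (permOfBlocks (blocksOfPerm y)) ≡ proj₁ y
  permOfBlocks∘blocksOfPerm y@(π , perm , av) =
    values-injective (trans (values-perm (blocksOfPerm y)) (blocksPerm-decode π perm av))

  blocksOfPerm∘permOfBlocks : ∀ b → blocksOfPerm (permOfBlocks b) ≡ b
  blocksOfPerm∘permOfBlocks b@(bs , size) = Blocks-≡ $
    trans (cong (decodeBlocksPerm m) (values-perm b)) (decodeBlocksPerm-blocksPerm m 0 bs (≤-reflexive size))

lemma3 : (n : ℕ) → 2 ≤ n →
    Σ (F13 n → SH1 (n ∸ 1)) λ f →
    Σ (SH1 (n ∸ 1) → F13 n) λ g →
    ((x : F13 n) → proj₁ (g (f x)) ≡ proj₁ x) ×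
    ((y : SH1 (n ∸ 1)) → proj₁ (f (g y)) ≡ proj₁ y)
lemma3 (suc zero) (s≤s ())
lemma3 (suc (suc k)) _ =
  (λ x → permOfBlocks (blocksOfWord x)) , (λ y → wordOfBlocks (blocksOfPerm y)) ,
  (λ x → trans (cong (λ b → proj₁ (wordOfBlocks b)) (blocksOfPerm∘permOfBlocks (blocksOfWord x)))
               (wordOfBlocks∘blocksOfWord x)) ,
  (λ y → trans (cong (λ b → proj₁ (permOfBlocks b)) (blocksOfWord∘wordOfBlocks (blocksOfPerm y)))
               (permOfBlocks∘blocksOfPerm y))
  where
  open Words (suc k)
  open Perms (suc k)
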